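{- Let $w\in S_n$, $D\in RP(w)$ and $1\le i<n$. Then the lowering crystal chute move $f_i$ is well defined with $f_i(D)\in RP(w)\cup\{0\}$. That is, whenever neither of the two conditions forcing $f_i(D)=0$ holds, a positive integer $m$ satisfying conditions (a) and (b) below exists, and the resulting diagram $f_i(D)$ is a reduced pipe dream for $w$. Moreover, if $f_i(D)\neq 0$, then $\operatorname{wt}(f_i(D))=\operatorname{wt}(D)-\alpha_i$, where $\alpha_i=\mathbf e_i-\mathbf e_{i+1}$ and $\mathbf e_k$ denotes the $k$-th standard basis vector of $\mathbb Z^n$.
   Context: Write $w=[w_1\cdots w_n]$ with $w_i=w(i)$. Index the boxes of the $n\times n$ grid by $(i,j)$, row $i$ from the top, column $j$ from the left. Pipe dreams. A pipe dream is a covering of each box by a cross tile or an elbow tile, where crosses are only allowed in boxes with $i+j\le n$. Connecting tiles gives pipes that enter at the left of each row and exit at the top of a column: a cross lets one pipe pass horizontally and one vertically; an elbow joins the left edge to the top edge and the bottom edge to the right edge. $D$ is a pipe dream for $w$ if the pipe entering row $i$ exits from column $w_i$ for all $i$. It is reduced if any two pipes cross at most once. $RP(w)$ is the set of reduced pipe dreams for $w$. $D_+$ is the set of boxes carrying crosses; it determines $D$. The weight $\operatorname{wt}(D)\in\mathbb Z_{\ge0}^n$ has $i$-th coordinate equal to the number of crosses in row $i$. Pairing process on row $i$. The crosses of row $i$ are considered from right to left. The cross $(i,j)$ is paired with the leftmost not-yet-paired cross of row $i+1$ lying in a column $\ge j$, if one exists; otherwise it is unpaired. Lowering crystal chute move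 $f_i$. Run the pairing process on row $i$. If every cross in row $i$ is paired, set $f_i(D)=0$. Otherwise let $(i,j)$ be the leftmost unpaired cross in row $i$. If $(i,k)\in D_+$ for all $1\le k\le j$, set $f_i(D)=0$. Otherwise let $m$ be a positive integer such that (a) $(i,j-m)\notin D_+$ and $(i+1,j-m)\notin D_+$, and (b) $(i,j-k)\in D_+$ and $(i+1,j-k)\in D_+$ for all $1\le k<m$, and define $f_i(D)$ by $f_i(D)_+=(D_+\setminus\{(i,j)\})\cup\{(i+1,j-m)\}$. -}

module Defs where

open import Data.Bool using (Bool; true; false; if_then_else_)
open import Data.Nat using (ℕ; zero; suc; _+_; _*_; _∸_; _≤_; _<_; _≤ᵇ_; _≡ᵇ_)
open import Data.Integer as ℤ using (ℤ; +_)
open import Data.List using (List; []; _∷_; _++_; length; filterᵇ; applyUpTo; reverse)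
open import Data.Maybe using (Maybe; just; nothing)
open import Data.Product using (_×_; _,_; proj₁; proj₂; ∃)
open import Data.Fin using (Fin; toℕ)
open import Data.Fin.Permutation using (Permutation′; _⟨$⟩ʳ_)
open import Relation.Binary.PropositionalEquality using (_≡_)

-- A diagram on the n×n grid: D i j = true iff box (i,j) (1-indexed,
-- row i from the top, column j from the left) carries a cross.
-- All other boxes carry elbows.  This is the set D_+.
Diagram : Set
Diagram = ℕ → ℕ → Bool

IsPipeDream : ℕ → Diagram → Set
IsPipeDream n D = ∀ i j → D i j ≡ true → (1 ≤ i) × (1 ≤ j) × (i + j ≤ n)

data Dir : Set where
  fromLeft fromBottom : Dir

-- Result of tracing: list of boxes visited (in order) and the column
-- from whose top the pipe exits (nothing if fuel runs out).
mutual
  trace : ℕ → Diagram → ℕ → ℕ → Dir → List (ℕ × ℕ) × Maybe ℕ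
  trace zero    D r c d = [] , nothing
  trace (suc f) D r c fromLeft with D r c
  ... | true  = addBox r c (trace f D r (suc c) fromLeft)
  ... | false = addBox r c (goUp f D r c)
  trace (suc f) D r c fromBottom with D r c
  ... | true  = addBox r c (goUp f D r c)
  ... | false = addBox r c (trace f D r (suc c) fromLeft)

  goUp : ℕ → Diagram → ℕ → ℕ → List (ℕ × ℕ) × Maybe ℕ
  goUp f D zero          c = [] , nothing
  goUp f D (suc zero)    c = [] , just c
  goUp f D (suc (suc r)) c = trace f D (suc r) c fromBottom

  addBox : ℕ → ℕ → List (ℕ × ℕ) × Maybe ℕ → List (ℕ × ℕ) × Maybe ℕ
  addBox r c (bs , e) = ((r , c) ∷ bs) , e

-- The pipe entering the left of row i (enough fuel: each step moves up or right).
pipe : ℕ → Diagram → ℕ → List (ℕ × ℕ) × Maybe ℕ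
pipe n D i = trace (2 * n + 2) D i 1 fromLeft

exitCol : ℕ → Diagram → ℕ → Maybe ℕ
exitCol n D i = proj₂ (pipe n D i)

pipeCrosses : ℕ → Diagram → ℕ → List (ℕ × ℕ)
pipeCrosses n D i = filterᵇ (λ b → D (proj₁ b) (proj₂ b)) (proj₁ (pipe n D i))

sameBox : ℕ × ℕ → ℕ × ℕ → Bool
sameBox (a , b) (c , d) = if a ≡ᵇ c then b ≡ᵇ d else false

elemBox : ℕ × ℕ → List (ℕ × ℕ) → Bool
elemBox x []       = false
elemBox x (y ∷ ys) = if sameBox x y then true else elemBox x ys

crossCount : ℕ → Diagram → ℕ → ℕ → ℕ
crossCount n D p q = length (filterᵇ (λ b → elemBox b (pipeCrosses n D q)) (pipeCrosses n D p))

IsPipeDreamFor : (n : ℕ) → Permutation′ n → Diagram → Set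
IsPipeDreamFor n w D = ∀ (i : Fin n) → exitCol n D (suc (toℕ i)) ≡ just (suc (toℕ (w ⟨$⟩ʳ i)))

IsReduced : ℕ → Diagram → Set
IsReduced n D = ∀ p q → 1 ≤ p → p < q → q ≤ n → crossCount n D p q ≤ 1

InRP : (n : ℕ) → Permutation′ n → Diagram → Set
InRP n w D = IsPipeDream n D × IsPipeDreamFor n w D × IsReduced n D

rowCols : ℕ → Diagram → ℕ → List ℕ
rowCols n D i = filterᵇ (D i) (applyUpTo suc n)

wt : ℕ → Diagram → ℕ → ℤ
wt n D r = + length (rowCols n D r)

alpha : ℕ → ℕ → ℤ
alpha i r = if r ≡ᵇ i then + 1 else (if r ≡ᵇ suc i then ℤ.-[1+ 0 ] else + 0)

removeLeftmostGE : ℕ → List ℕ → Maybe (List ℕ)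
removeLeftmostGE j []       = nothing
removeLeftmostGE j (c ∷ cs) with j ≤ᵇ c
... | true  = just cs
... | false = Data.Maybe.map (c ∷_) (removeLeftmostGE j cs)
  where import Data.Maybe

-- first argument: crosses of row i from right to left;
-- second: not-yet-paired crosses of row i+1 (increasing columns).
-- Output: the unpaired crosses of row i.
unpairedCols : List ℕ → List ℕ → List ℕ
unpairedCols []       av = []
unpairedCols (j ∷ js) av with removeLeftmostGE j av
... | just av' = unpairedCols js av'
... | nothing  = j ∷ unpairedCols js av

unpaired : ℕ → Diagram → ℕ → List ℕ
unpaired n D i = unpairedCols (reverse (rowCols n D i)) (rowCols n D (suc i))

minimumM : List ℕ → Maybe ℕ
minimumM []       = nothing
minimumM (x ∷ xs) with minimumM xs
... | nothing = just x
... | just y  = just (if x ≤ᵇ y then x else y)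

leftmostUnpaired : ℕ → Diagram → ℕ → Maybe ℕ
leftmostUnpaired n D i = minimumM (unpaired n D i)

ValidM : Diagram → ℕ → ℕ → ℕ → Set
ValidM D i j m =
  (1 ≤ m) × (m < j)
  × ((D i (j ∸ m) ≡ false) × (D (suc i) (j ∸ m) ≡ false))
  × (∀ k → 1 ≤ k → k < m → (D i (j ∸ k) ≡ true) × (D (suc i) (j ∸ k) ≡ true))

chuteMove : Diagram → ℕ → ℕ → ℕ → Diagram
chuteMove D i j m r c =
  if (r ≡ᵇ suc i) Data.Bool.∧ (c ≡ᵇ (j ∸ m)) then true
  else (if (r ≡ᵇ i) Data.Bool.∧ (c ≡ᵇ j) then false else D r c)
  where import Data.Bool

-- Let j be the leftmost unpaired cross of row i. The pairing process forces the shape of rows i and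
-- i+1 to the left of j: (i+1, j) is an elbow, and if (i, a) is the first elbow of row i to the left of
-- j, every box strictly between columns a and j is a cross in both rows. Then (i+1, a) is an elbow as
-- well, for otherwise the pipe passing it vertically and the pipe passing it horizontally would both
-- pass the cross (i, j) and cross twice; this gives m = j - a. Moving the cross from (i, j) to (i+1, a)
-- only reroutes pipes inside this two-row rectangle: every pipe keeps its exit, and the crosses it
-- meets are transformed by one involution of the boxes, so any two pipes still share as many crosses.
-- The weight changes because one cross leaves row i and one enters row i+1.

{-# OPTIONS --safe #-}
module Submission where

open import Defs
open import Data.Bool using (Bool; true; false; T; _∧_; if_then_else_)
open import Data.Bool.Properties using (T-≡; ∧-conicalˡ; ∧-conicalʳ)
open import Data.Empty using (⊥; ⊥-elim)
open import Data.Fin using (toℕ; fromℕ<)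
open import Data.Fin.Properties using (toℕ-fromℕ<)
open import Data.Fin.Permutation using (Permutation′; _⟨$⟩ʳ_)
open import Data.Integer using (+_; _-_)
open import Data.List using (List; []; _∷_; _++_; [_]; length; map; filterᵇ; applyUpTo; reverse; reverseAcc)
open import Data.List.Properties using (length-map; map-++; ++-assoc; ++-identityʳ; filter-++; filter-some; filter-all; applyUpTo-∷ʳ; map-applyUpTo)
open import Data.List.Membership.Propositional using (_∈_; lose)
open import Data.List.Membership.Propositional.Properties using (∈-applyUpTo⁻; ∈-applyUpTo⁺; ∈-filter⁻; ∈-filter⁺; ∈-++⁺ˡ; ∈-++⁺ʳ)
open import Data.List.Relation.Unary.All using (All; []; _∷_)
import Data.List.Relation.Unary.All as All
import Data.List.Relation.Unary.All.Properties as All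
open import Data.List.Relation.Unary.Any using (here; there)
import Data.List.Relation.Unary.Any as Any
import Data.List.Relation.Unary.Any.Properties as Any
open import Data.List.Relation.Unary.AllPairs using (AllPairs; []; _∷_)
import Data.List.Relation.Unary.AllPairs as AllPairs
import Data.List.Relation.Unary.AllPairs.Properties as AllPairs
open import Data.List.Relation.Binary.Permutation.Propositional using (_↭_; prep; swap; ↭-refl; ↭-trans; ↭-reflexive)
import Data.List.Relation.Binary.Permutation.Propositional as Perm
open import Data.List.Relation.Binary.Permutation.Propositional.Properties using (↭-length; ++⁺; filter-↭; ∷↭∷ʳ)
open import Data.Maybe using (Maybe; just; nothing)
open import Data.Nat
open import Data.Nat.Properties
open import Data.Product using (∃; _×_; _,_; proj₁; proj₂)
open import Data.Sum using (_⊎_; inj₁; inj₂; [_,_]′)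
open import Function using (_∘_; Equivalence)
open import Relation.Binary using (tri<; tri≈; tri>)
open import Relation.Binary.Construct.Closure.ReflexiveTransitive using (Star; ε; _◅_; _◅◅_)
open import Relation.Binary.PropositionalEquality hiding ([_])
open import Relation.Nullary using (¬_; Dec; yes; no; contradiction)
open import Relation.Nullary.Decidable using (T?; _×-dec_; _⊎-dec_)

≡ᵇ-refl : ∀ m → (m ≡ᵇ m) ≡ true
≡ᵇ-refl m = Equivalence.to T-≡ (≡⇒≡ᵇ m m refl)

≡ᵇ-sound : ∀ {m n} → (m ≡ᵇ n) ≡ true → m ≡ n
≡ᵇ-sound {m} {n} e = ≡ᵇ⇒≡ m n (Equivalence.from T-≡ e)

≡ᵇ-≢ : ∀ {m n} → m ≢ n → (m ≡ᵇ n) ≡ false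
≡ᵇ-≢ {m} {n} m≢n with m ≡ᵇ n in e
... | true  = contradiction (≡ᵇ-sound e) m≢n
... | false = refl

<ᵇ-complete : ∀ {m n} → m < n → (m <ᵇ n) ≡ true
<ᵇ-complete m<n = Equivalence.to T-≡ (<⇒<ᵇ m<n)

<ᵇ-sound : ∀ {m n} → (m <ᵇ n) ≡ true → m < n
<ᵇ-sound {m} {n} e = <ᵇ⇒< m n (Equivalence.from T-≡ e)

<ᵇ-≮ : ∀ {m n} → ¬ m < n → (m <ᵇ n) ≡ false
<ᵇ-≮ {m} {n} m≮n with m <ᵇ n in e
... | true  = contradiction (<ᵇ-sound e) m≮n
... | false = refl

≤ᵇ-sound : ∀ {m n} → (m ≤ᵇ n) ≡ true → m ≤ n
≤ᵇ-sound {m} {n} e = ≤ᵇ⇒≤ m n (Equivalence.from T-≡ e)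

≤ᵇ-false : ∀ {m n} → (m ≤ᵇ n) ≡ false → n < m
≤ᵇ-false e = ≰⇒> (λ m≤n → subst T e (≤⇒≤ᵇ m≤n))

∧-true : ∀ {x y} → (x ∧ y) ≡ true → x ≡ true × y ≡ true
∧-true {x} {y} e = ∧-conicalˡ x y e , ∧-conicalʳ x y e

-- Pipes as paths of states

data State : Set where
  state : (r c : ℕ) → Dir → State

rowOf colOf : State → ℕ
rowOf (state r _ _) = r
colOf (state _ c _) = c

box : State → ℕ × ℕ
box (state r c _) = r , c

traceFrom : ℕ → Diagram → State → List (ℕ × ℕ) × Maybe ℕ
traceFrom f D (state r c d) = trace f D r c d

data Step (D : Diagram) : State → State → Set where
  passRight : ∀ {r c} → D r c ≡ true → Step D (state r c fromLeft) (state r (suc c) fromLeft)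
  turnUp    : ∀ {r c} → D (suc (suc r)) c ≡ false → Step D (state (suc (suc r)) c fromLeft) (state (suc r) c fromBottom)
  passUp    : ∀ {r c} → D (suc (suc r)) c ≡ true → Step D (state (suc (suc r)) c fromBottom) (state (suc r) c fromBottom)
  turnRight : ∀ {r c} → D r c ≡ false → Step D (state r c fromBottom) (state r (suc c) fromLeft)

Path : Diagram → State → State → Set
Path D = Star (Step D)

pathLength : ∀ {D s t} → Path D s t → ℕ
pathLength ε       = 0
pathLength (_ ◅ p) = suc (pathLength p)

pathBoxes : ∀ {D s t} → Path D s t → List (ℕ × ℕ)
pathBoxes ε               = []
pathBoxes {s = s} (_ ◅ p) = box s ∷ pathBoxes p

pathLength-◅◅ : ∀ {D s t u} (p : Path D s t) (q : Path D t u) → pathLength (p ◅◅ q) ≡ pathLength p + pathLength q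
pathLength-◅◅ ε       q = refl
pathLength-◅◅ (_ ◅ p) q = cong suc (pathLength-◅◅ p q)

pathBoxes-◅◅ : ∀ {D s t u} (p : Path D s t) (q : Path D t u) → pathBoxes (p ◅◅ q) ≡ pathBoxes p ++ pathBoxes q
pathBoxes-◅◅ ε       q = refl
pathBoxes-◅◅ (_ ◅ p) q = cong (_ ∷_) (pathBoxes-◅◅ p q)

prepend : List (ℕ × ℕ) → List (ℕ × ℕ) × Maybe ℕ → List (ℕ × ℕ) × Maybe ℕ
prepend bs (l , e) = bs ++ l , e

prepend-++ : ∀ xs ys z → prepend xs (prepend ys z) ≡ prepend (xs ++ ys) z
prepend-++ xs ys (l , e) = cong (_, e) (sym (++-assoc xs ys l))

trace-cross-fromLeft : ∀ D f r c → D r c ≡ true → trace (suc f) D r c fromLeft ≡ addBox r c (trace f D r (suc c) fromLeft)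
trace-cross-fromLeft D f r c e rewrite e = refl

trace-elbow-fromLeft : ∀ D f r c → D r c ≡ false → trace (suc f) D r c fromLeft ≡ addBox r c (goUp f D r c)
trace-elbow-fromLeft D f r c e rewrite e = refl

trace-cross-fromBottom : ∀ D f r c → D r c ≡ true → trace (suc f) D r c fromBottom ≡ addBox r c (goUp f D r c)
trace-cross-fromBottom D f r c e rewrite e = refl

trace-elbow-fromBottom : ∀ D f r c → D r c ≡ false → trace (suc f) D r c fromBottom ≡ addBox r c (trace f D r (suc c) fromLeft)
trace-elbow-fromBottom D f r c e rewrite e = refl

trace-path : ∀ {D s t} (p : Path D s t) f → traceFrom (pathLength p + f) D s ≡ prepend (pathBoxes p) (traceFrom f D t)
trace-path ε f = refl
trace-path (passRight {r} {c} e ◅ p) f = trans (trace-cross-fromLeft _ _ r c e) (cong (addBox r c) (trace-path p f))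
trace-path (turnUp {r} {c} e ◅ p) f = trans (trace-elbow-fromLeft _ _ (suc (suc r)) c e) (cong (addBox _ c) (trace-path p f))
trace-path (passUp {r} {c} e ◅ p) f = trans (trace-cross-fromBottom _ _ (suc (suc r)) c e) (cong (addBox _ c) (trace-path p f))
trace-path (turnRight {r} {c} e ◅ p) f = trans (trace-elbow-fromBottom _ _ r c e) (cong (addBox r c) (trace-path p f))

trace-outOfFuel : ∀ {D s t} (p : Path D s t) f → f ≤ pathLength p → proj₂ (traceFrom f D s) ≡ nothing
trace-outOfFuel {s = state r c d} p zero _ = refl
trace-outOfFuel (passRight {r} {c} e ◅ p) (suc f) (s≤s f≤) rewrite e = trace-outOfFuel p f f≤
trace-outOfFuel (turnUp e ◅ p) (suc f) (s≤s f≤) rewrite e = trace-outOfFuel p f f≤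
trace-outOfFuel (passUp e ◅ p) (suc f) (s≤s f≤) rewrite e = trace-outOfFuel p f f≤
trace-outOfFuel (turnRight e ◅ p) (suc f) (s≤s f≤) rewrite e = trace-outOfFuel p f f≤

fuel-exceeds-path : ∀ {D s t} (p : Path D s t) f {e} → proj₂ (traceFrom f D s) ≡ just e → ∃ λ g → f ≡ pathLength p + suc g
fuel-exceeds-path p f ex with f ≤? pathLength p
... | yes f≤ = contradiction (trans (sym (trace-outOfFuel p f f≤)) ex) λ ()
... | no f≰ = f ∸ suc (pathLength p) , (begin
  f                                        ≡⟨ m+[n∸m]≡n (≰⇒> f≰) ⟨
  suc (pathLength p) + (f ∸ suc (pathLength p)) ≡⟨ +-suc (pathLength p) _ ⟨
  pathLength p + suc (f ∸ suc (pathLength p))   ∎)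
  where open ≡-Reasoning

step-deterministic : ∀ {D s t u} → Step D s t → Step D s u → t ≡ u
step-deterministic (passRight _) (passRight _) = refl
step-deterministic (passRight x) (turnUp y)    = contradiction (trans (sym x) y) λ ()
step-deterministic (turnUp x)    (passRight y) = contradiction (trans (sym y) x) λ ()
step-deterministic (turnUp _)    (turnUp _)    = refl
step-deterministic (passUp _)    (passUp _)    = refl
step-deterministic (passUp x)    (turnRight y) = contradiction (trans (sym x) y) λ ()
step-deterministic (turnRight x) (passUp y)    = contradiction (trans (sym y) x) λ ()
step-deterministic (turnRight _) (turnRight _) = refl

paths-comparable : ∀ {D s t u} → Path D s t → Path D s u → Path D t u ⊎ Path D u t
paths-comparable ε       q       = inj₁ q
paths-comparable p       ε       = inj₂ p
paths-comparable (x ◅ p) (y ◅ q) with step-deterministic x y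
... | refl = paths-comparable p q

path-potential : ∀ {D s t} (p : Path D s t) → colOf t + rowOf s ≡ pathLength p + (colOf s + rowOf t)
path-potential ε = refl
path-potential (passRight _ ◅ p) = trans (path-potential p) (+-suc _ _)
path-potential {t = t} (turnUp {r} _ ◅ p) = trans (+-suc (colOf t) (suc r)) (cong suc (path-potential p))
path-potential {t = t} (passUp {r} _ ◅ p) = trans (+-suc (colOf t) (suc r)) (cong suc (path-potential p))
path-potential (turnRight _ ◅ p) = trans (path-potential p) (+-suc _ _)

path-noLoop : ∀ {D r c d d'} → Path D (state r c d) (state r c d') → d ≡ d'
path-noLoop ε = refl
path-noLoop {r = r} {c} p@(_ ◅ q) = contradiction (path-potential p) (m≢1+n+m (c + r) {pathLength q})

traceFrom-visits : ∀ f D s → ∃ λ rest → proj₁ (traceFrom (suc f) D s) ≡ box s ∷ rest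
traceFrom-visits f D (state r c fromLeft) with D r c
... | true  = _ , refl
... | false = _ , refl
traceFrom-visits f D (state r c fromBottom) with D r c
... | true  = _ , refl
... | false = _ , refl

pipe-prefix : ∀ {n D p s e} (π : Path D (state p 1 fromLeft) s) → exitCol n D p ≡ just e →
  ∃ λ rest → proj₁ (pipe n D p) ≡ pathBoxes π ++ box s ∷ rest
pipe-prefix {n} {D} {p} {s} π ex with fuel-exceeds-path π (2 * n + 2) ex
... | g , fuel with traceFrom-visits g D s
...   | rest , visits = rest , (begin
  proj₁ (pipe n D p)                                                ≡⟨ cong (λ f → proj₁ (traceFrom f D (state p 1 fromLeft))) fuel ⟩
  proj₁ (traceFrom (pathLength π + suc g) D (state p 1 fromLeft))   ≡⟨ cong proj₁ (trace-path π (suc g)) ⟩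
  pathBoxes π ++ proj₁ (traceFrom (suc g) D s)                      ≡⟨ cong (pathBoxes π ++_) visits ⟩
  pathBoxes π ++ box s ∷ rest                                       ∎)
  where open ≡-Reasoning

record PipeThrough (n : ℕ) (D : Diagram) (s : State) : Set where
  constructor pipeThrough
  field
    start   : ℕ
    1≤start : 1 ≤ start
    start≤n : start ≤ n
    route   : Path D (state start 1 fromLeft) s

extendPipe : ∀ {n D s t} → PipeThrough n D s → Step D s t → PipeThrough n D t
extendPipe (pipeThrough p 1≤p p≤n π) x = pipeThrough p 1≤p p≤n (π ◅◅ (x ◅ ε))

module _ {n : ℕ} {D : Diagram} (pd : IsPipeDream n D) where

  -- s = n ∸ (r + suc c) shrinks as the backward walk moves down a column, so the recursion terminates.
  mutual
    pipeThrough-fromLeft : ∀ r c → 1 ≤ r → r + c ≤ n → PipeThrough n D (state r (suc c) fromLeft)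
    pipeThrough-fromLeft r zero    1≤r r+c≤n = pipeThrough r 1≤r (subst (_≤ n) (+-identityʳ r) r+c≤n) ε
    pipeThrough-fromLeft r (suc c) 1≤r r+c≤n with D r (suc c) in e
    ... | true  = extendPipe (pipeThrough-fromLeft r c 1≤r (≤-trans (+-monoʳ-≤ r (n≤1+n c)) r+c≤n)) (passRight e)
    ... | false = extendPipe (pipeThrough-fromBottom′ r c (n ∸ (r + suc c)) 1≤r (m+[n∸m]≡n r+c≤n)) (turnRight e)

    pipeThrough-fromBottom′ : ∀ r c s → 1 ≤ r → r + suc c + s ≡ n → PipeThrough n D (state r (suc c) fromBottom)
    pipeThrough-fromBottom′ (suc r) c s _ r+c+s≡n with D (suc (suc r)) (suc c) in e
    pipeThrough-fromBottom′ (suc r) c zero _ r+c+s≡n | true =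
      contradiction (proj₂ (proj₂ (pd _ _ e))) (<-irrefl (trans (sym (+-identityʳ _)) r+c+s≡n))
    pipeThrough-fromBottom′ (suc r) c (suc s) _ r+c+s≡n | true =
      extendPipe (pipeThrough-fromBottom′ (suc (suc r)) c s (s≤s z≤n) (trans (sym (+-suc (suc r + suc c) s)) r+c+s≡n)) (passUp e)
    ... | false =
      extendPipe (pipeThrough-fromLeft (suc (suc r)) c (s≤s z≤n)
        (subst₂ _≤_ (cong suc (+-suc r c)) r+c+s≡n (m≤m+n (suc r + suc c) s))) (turnUp e)

  pipeThrough-fromBottom : ∀ r c → 1 ≤ r → r + suc c ≤ n → PipeThrough n D (state r (suc c) fromBottom)
  pipeThrough-fromBottom r c 1≤r r+c≤n = pipeThrough-fromBottom′ r c (n ∸ (r + suc c)) 1≤r (m+[n∸m]≡n r+c≤n)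

rowSegment : ℕ → ℕ → ℕ → List (ℕ × ℕ)
rowSegment r a w = applyUpTo (λ t → r , suc t + a) w

crossRun : ∀ {D : Diagram} r a w → (∀ t → t < w → D r (suc t + a) ≡ true) →
  Path D (state r (suc a) fromLeft) (state r (suc w + a) fromLeft)
crossRun     r a zero    full = ε
crossRun {D} r a (suc w) full = crossRun {D} r a w (λ t → full t ∘ m<n⇒m<1+n) ◅◅ passRight (full w (n<1+n w)) ◅ ε

pathLength-crossRun : ∀ {D : Diagram} r a w (full : ∀ t → t < w → D r (suc t + a) ≡ true) →
  pathLength (crossRun {D} r a w full) ≡ w
pathLength-crossRun     r a zero    full = refl
pathLength-crossRun {D} r a (suc w) full = begin
  pathLength (crossRun {D} r a w _ ◅◅ _) ≡⟨ pathLength-◅◅ (crossRun {D} r a w _) _ ⟩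
  pathLength (crossRun {D} r a w _) + 1  ≡⟨ cong (_+ 1) (pathLength-crossRun {D} r a w _) ⟩
  w + 1                                  ≡⟨ +-comm w 1 ⟩
  suc w                                  ∎
  where open ≡-Reasoning

pathBoxes-crossRun : ∀ {D : Diagram} r a w (full : ∀ t → t < w → D r (suc t + a) ≡ true) →
  pathBoxes (crossRun {D} r a w full) ≡ rowSegment r a w
pathBoxes-crossRun     r a zero    full = refl
pathBoxes-crossRun {D} r a (suc w) full = begin
  pathBoxes (crossRun {D} r a w _ ◅◅ _)          ≡⟨ pathBoxes-◅◅ (crossRun {D} r a w _) _ ⟩
  pathBoxes (crossRun {D} r a w _) ++ [ r , suc w + a ] ≡⟨ cong (_++ [ r , suc w + a ]) (pathBoxes-crossRun {D} r a w _) ⟩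
  rowSegment r a w ++ [ r , suc w + a ]          ≡⟨ applyUpTo-∷ʳ (λ t → r , suc t + a) w ⟩
  rowSegment r a (suc w)                         ∎
  where open ≡-Reasoning

sameBox-refl : ∀ x → sameBox x x ≡ true
sameBox-refl (p , q) rewrite ≡ᵇ-refl p = ≡ᵇ-refl q

sameBox-sound : ∀ x y → sameBox x y ≡ true → x ≡ y
sameBox-sound (p , q) (p' , q') e with p ≡ᵇ p' in e₁
... | true  = cong₂ _,_ (≡ᵇ-sound e₁) (≡ᵇ-sound e)

elemBox-complete : ∀ {x L} → x ∈ L → elemBox x L ≡ true
elemBox-complete {x} (here refl) rewrite sameBox-refl x = refl
elemBox-complete {x} {y ∷ _} (there x∈L) with sameBox x y
... | true  = refl
... | false = elemBox-complete x∈L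

elemBox-map : ∀ (f : ℕ × ℕ → ℕ × ℕ) → (∀ {x y} → f x ≡ f y → x ≡ y) → ∀ b L →
  elemBox (f b) (map f L) ≡ elemBox b L
elemBox-map f inj b [] = refl
elemBox-map f inj b (y ∷ L) with sameBox b y in e
... | true rewrite sameBox-sound b y e | sameBox-refl (f y) = refl
... | false with sameBox (f b) (f y) in e′
...   | true  = contradiction (trans (sym (trans (cong (λ z → sameBox z y) (inj (sameBox-sound _ _ e′))) (sameBox-refl y))) e) λ ()
...   | false = elemBox-map f inj b L

elemBox-↭ : ∀ b {L L'} → L ↭ L' → elemBox b L ≡ elemBox b L'
elemBox-↭ b Perm.refl = refl
elemBox-↭ b (prep x p) with sameBox b x
... | true  = refl
... | false = elemBox-↭ b p
elemBox-↭ b (swap x y p) with sameBox b x | sameBox b y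
... | true  | true  = refl
... | true  | false = refl
... | false | true  = refl
... | false | false = elemBox-↭ b p
elemBox-↭ b (Perm.trans p q) = trans (elemBox-↭ b p) (elemBox-↭ b q)

filterᵇ-cong : ∀ {A : Set} (p q : A → Bool) L → (∀ x → x ∈ L → p x ≡ q x) → filterᵇ p L ≡ filterᵇ q L
filterᵇ-cong p q [] _ = refl
filterᵇ-cong p q (x ∷ L) p≗q with p x in e₁ | q x in e₂
... | true  | true  = cong (x ∷_) (filterᵇ-cong p q L (λ y y∈L → p≗q y (there y∈L)))
... | false | false = filterᵇ-cong p q L (λ y y∈L → p≗q y (there y∈L))
... | true  | false = contradiction (trans (sym e₁) (trans (p≗q x (here refl)) e₂)) λ ()
... | false | true  = contradiction (trans (sym e₂) (trans (sym (p≗q x (here refl))) e₁)) λ ()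

filterᵇ-map : ∀ {A : Set} (p : A → Bool) (f : A → A) L → filterᵇ p (map f L) ≡ map f (filterᵇ (p ∘ f) L)
filterᵇ-map p f [] = refl
filterᵇ-map p f (x ∷ L) with p (f x)
... | true  = cong (f x ∷_) (filterᵇ-map p f L)
... | false = filterᵇ-map p f L

length-filterᵇ-toggle : ∀ {A : Set} (P Q : A → Bool) {x} L → AllPairs _≢_ L → x ∈ L →
  (∀ y → y ≢ x → P y ≡ Q y) → P x ≡ false → Q x ≡ true →
  length (filterᵇ Q L) ≡ suc (length (filterᵇ P L))
length-filterᵇ-toggle P Q (x ∷ L) (x∉L ∷ _) (here refl) P≗Q Px Qx rewrite Px | Qx =
  cong (suc ∘ length) (filterᵇ-cong Q P L (λ y y∈L → sym (P≗Q y (λ { refl → All.lookup x∉L y∈L refl }))))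
length-filterᵇ-toggle P Q (z ∷ L) (z∉L ∷ uL) (there x∈L) P≗Q Px Qx
  rewrite P≗Q z (All.lookup z∉L x∈L) with Q z
... | true  = cong suc (length-filterᵇ-toggle P Q L uL x∈L P≗Q Px Qx)
... | false = length-filterᵇ-toggle P Q L uL x∈L P≗Q Px Qx

2≤length-filterᵇ : ∀ {A : Set} (P : A → Bool) {x y} L → x ∈ L → y ∈ L → x ≢ y → P x ≡ true → P y ≡ true →
  2 ≤ length (filterᵇ P L)
2≤length-filterᵇ P (z ∷ L) (here refl) (here refl) x≢y _ _ = contradiction refl x≢y
2≤length-filterᵇ P (z ∷ L) (here refl) (there y∈L) _ Px Py rewrite Px =
  s≤s (filter-some (T? ∘ P) (lose y∈L (Equivalence.from T-≡ Py)))
2≤length-filterᵇ P (z ∷ L) (there x∈L) (here refl) _ Px Py rewrite Py =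
  s≤s (filter-some (T? ∘ P) (lose x∈L (Equivalence.from T-≡ Px)))
2≤length-filterᵇ P (z ∷ L) (there x∈L) (there y∈L) x≢y Px Py with P z
... | true  = m≤n⇒m≤1+n (2≤length-filterᵇ P L x∈L y∈L x≢y Px Py)
... | false = 2≤length-filterᵇ P L x∈L y∈L x≢y Px Py

crossesOn : Diagram → List (ℕ × ℕ) → List (ℕ × ℕ)
crossesOn E = filterᵇ (λ b → E (proj₁ b) (proj₂ b))

crossesOn-cross : ∀ E {r c} l → E r c ≡ true → crossesOn E ((r , c) ∷ l) ≡ (r , c) ∷ crossesOn E l
crossesOn-cross E l cross rewrite cross = refl

crossesOn-elbow : ∀ E {r c} l → E r c ≡ false → crossesOn E ((r , c) ∷ l) ≡ crossesOn E l
crossesOn-elbow E l elbow rewrite elbow = refl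

crossesOn-++ : ∀ E xs ys → crossesOn E (xs ++ ys) ≡ crossesOn E xs ++ crossesOn E ys
crossesOn-++ E = filter-++ (λ b → T? (E (proj₁ b) (proj₂ b)))

crossesOn-crossRun : ∀ E r a w (full : ∀ t → t < w → E r (suc t + a) ≡ true) l →
  crossesOn E (pathBoxes (crossRun {E} r a w full) ++ l) ≡ rowSegment r a w ++ crossesOn E l
crossesOn-crossRun E r a w full l = begin
  crossesOn E (pathBoxes (crossRun {E} r a w full) ++ l)  ≡⟨ cong (λ bs → crossesOn E (bs ++ l)) (pathBoxes-crossRun {E} r a w full) ⟩
  crossesOn E (rowSegment r a w ++ l)                     ≡⟨ crossesOn-++ E (rowSegment r a w) l ⟩
  crossesOn E (rowSegment r a w) ++ crossesOn E l         ≡⟨ cong (_++ crossesOn E l) allCrosses ⟩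
  rowSegment r a w ++ crossesOn E l                       ∎
  where
  open ≡-Reasoning
  allCrosses : crossesOn E (rowSegment r a w) ≡ rowSegment r a w
  allCrosses = filter-all (λ b → T? (E (proj₁ b) (proj₂ b)))
    (All.applyUpTo⁺₁ _ w (λ t<w → Equivalence.from T-≡ (full _ t<w)))

applyUpTo-cong : ∀ {A : Set} (f g : ℕ → A) k → (∀ t → t < k → f t ≡ g t) → applyUpTo f k ≡ applyUpTo g k
applyUpTo-cong f g zero    f≗g = refl
applyUpTo-cong f g (suc k) f≗g = cong₂ _∷_ (f≗g 0 z<s) (applyUpTo-cong (f ∘ suc) (g ∘ suc) k (λ t → f≗g (suc t) ∘ s<s))

-- The pairing process

Increasing Decreasing : List ℕ → Set
Increasing = AllPairs _<_
Decreasing = AllPairs _>_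

reverseAcc-decreasing : ∀ acc xs → Decreasing acc → Increasing xs → All (λ a → All (a <_) xs) acc →
  Decreasing (reverseAcc acc xs)
reverseAcc-decreasing acc []       dec _          _   = dec
reverseAcc-decreasing acc (x ∷ xs) dec (x< ∷ inc) acc< =
  reverseAcc-decreasing (x ∷ acc) xs (All.map All.head acc< ∷ dec) inc (x< ∷ All.map All.tail acc<)

reverse-decreasing : ∀ xs → Increasing xs → Decreasing (reverse xs)
reverse-decreasing xs inc = reverseAcc-decreasing [] xs [] inc []

minimumM-nothing : ∀ xs → minimumM xs ≡ nothing → xs ≡ []
minimumM-nothing []       _ = refl
minimumM-nothing (x ∷ xs) e with minimumM xs
minimumM-nothing (x ∷ xs) () | nothing
minimumM-nothing (x ∷ xs) () | just _

minimumM-just : ∀ xs {j} → minimumM xs ≡ just j → j ∈ xs × (∀ x → x ∈ xs → j ≤ x)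
minimumM-just (x ∷ xs) e with minimumM xs in e′
minimumM-just (x ∷ xs) refl | nothing rewrite minimumM-nothing xs e′ =
  here refl , λ { _ (here refl) → ≤-refl }
minimumM-just (x ∷ xs) e | just y with minimumM-just xs e′ | x ≤ᵇ y in x≤ᵇy
minimumM-just (x ∷ xs) refl | just y | y∈xs , y≤ | true =
  here refl , λ { _ (here refl) → ≤-refl ; z (there z∈xs) → ≤-trans (≤ᵇ-sound x≤ᵇy) (y≤ z z∈xs) }
minimumM-just (x ∷ xs) refl | just y | y∈xs , y≤ | false =
  there y∈xs , λ { _ (here refl) → <⇒≤ (≤ᵇ-false x≤ᵇy) ; z (there z∈xs) → y≤ z z∈xs }

removeLeftmostGE-nothing : ∀ j av → removeLeftmostGE j av ≡ nothing → ∀ x → x ∈ av → x < j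
removeLeftmostGE-nothing j (c ∷ cs) e x x∈ with j ≤ᵇ c in j≤ᵇc
removeLeftmostGE-nothing j (c ∷ cs) () x x∈ | true
removeLeftmostGE-nothing j (c ∷ cs) e x x∈ | false with removeLeftmostGE j cs in e′
removeLeftmostGE-nothing j (c ∷ cs) e x (here refl) | false | nothing = ≤ᵇ-false j≤ᵇc
removeLeftmostGE-nothing j (c ∷ cs) e x (there x∈) | false | nothing = removeLeftmostGE-nothing j cs e′ x x∈

record LeftmostRemoved (j : ℕ) (av av' : List ℕ) : Set where
  field
    removed    : ℕ
    j≤removed  : j ≤ removed
    removed∈av : removed ∈ av
    increasing : Increasing av'
    remaining  : ∀ z → z ∈ av' → z ∈ av × z ≢ removed
    kept       : ∀ z → z ∈ av → z ≢ removed → z ∈ av'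

removeLeftmostGE-just : ∀ j av {av'} → Increasing av → removeLeftmostGE j av ≡ just av' → LeftmostRemoved j av av'
removeLeftmostGE-just j (x ∷ xs) (x< ∷ inc) e with j ≤ᵇ x in j≤ᵇx
removeLeftmostGE-just j (x ∷ xs) (x< ∷ inc) refl | true = record
  { removed = x ; j≤removed = ≤ᵇ-sound j≤ᵇx ; removed∈av = here refl ; increasing = inc
  ; remaining = λ z z∈ → there z∈ , λ { refl → <-irrefl refl (All.lookup x< z∈) }
  ; kept = λ { _ (here refl) x≢x → contradiction refl x≢x ; z (there z∈) _ → z∈ } }
removeLeftmostGE-just j (x ∷ xs) (x< ∷ inc) e | false with removeLeftmostGE j xs in e′
removeLeftmostGE-just j (x ∷ xs) (x< ∷ inc) refl | false | just av″ = record
  { removed = removed ; j≤removed = j≤removed ; removed∈av = there removed∈av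
  ; increasing = All.tabulate (λ z∈ → All.lookup x< (proj₁ (remaining _ z∈))) ∷ increasing
  ; remaining = λ { _ (here refl) → here refl , (λ { refl → <-irrefl refl (All.lookup x< removed∈av) })
                  ; z (there z∈) → there (proj₁ (remaining z z∈)) , proj₂ (remaining z z∈) }
  ; kept = λ { _ (here refl) _ → here refl ; z (there z∈) z≢ → there (kept z z∈ z≢) } }
  where open LeftmostRemoved (removeLeftmostGE-just j xs inc e′)

unpairedCols-⊆ : ∀ js av {x} → x ∈ unpairedCols js av → x ∈ js
unpairedCols-⊆ (j ∷ js) av x∈ with removeLeftmostGE j av
... | just av' = there (unpairedCols-⊆ js av' x∈)
unpairedCols-⊆ (j ∷ js) av (here refl) | nothing = here refl
unpairedCols-⊆ (j ∷ js) av (there x∈) | nothing = there (unpairedCols-⊆ js av x∈)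

-- Once nothing is left unpaired, the crosses are paired from the right and all available crosses lie
-- to the left of b, so each cross can only be paired with the one directly below it.
allPaired-fill : ∀ rest av b t → Decreasing rest → All (_< b) rest → Increasing av → (∀ x → x ∈ av → x < b) →
  (∀ x → ¬ x ∈ unpairedCols rest av) → (∀ c → t < c → c < b → c ∈ rest) →
  ∀ c → t < c → c < b → c ∈ av
allPaired-fill [] av b t _ _ _ _ _ full c t<c c<b with full c t<c c<b
... | ()
allPaired-fill (c₀ ∷ rest) av (suc b) t (c₀> ∷ dec) (c₀<b ∷ rest<b) inc av<b none full c t<c c<b
  with removeLeftmostGE c₀ av in e
... | nothing = contradiction (here refl) (none c₀)
... | just av' = c∈av
  where
  open LeftmostRemoved (removeLeftmostGE-just c₀ av inc e)
  c₀≡b : c₀ ≡ b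
  c₀≡b with full b (<-≤-trans t<c (≤-pred c<b)) ≤-refl
  ... | here b≡c₀ = sym b≡c₀
  ... | there b∈rest = contradiction (≤-pred c₀<b) (<⇒≱ (All.lookup c₀> b∈rest))
  removed≡b : removed ≡ b
  removed≡b = ≤-antisym (≤-pred (av<b removed removed∈av)) (subst (_≤ removed) c₀≡b j≤removed)
  full′ : ∀ c → t < c → c < b → c ∈ rest
  full′ c t<c c<b = Any.tail (λ c≡c₀ → <⇒≢ c<b (trans c≡c₀ c₀≡b)) (full c t<c (≤-trans c<b (n≤1+n b)))
  c∈av : c ∈ av
  c∈av with c ≟ b
  ... | yes refl = subst (_∈ av) removed≡b removed∈av
  ... | no c≢b = proj₁ (remaining c (allPaired-fill rest av' b t dec (subst (λ z → All (_< z) rest) c₀≡b c₀>) increasing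
          (λ x x∈ → ≤∧≢⇒< (≤-pred (av<b x (proj₁ (remaining x x∈))))
                          (λ x≡b → proj₂ (remaining x x∈) (trans x≡b (sym removed≡b))))
          none full′ c t<c (≤∧≢⇒< (≤-pred c<b) c≢b)))

unpairedCols-leftmost : ∀ js av j t → Decreasing js → Increasing av → j ∈ unpairedCols js av →
  (∀ x → x ∈ unpairedCols js av → j ≤ x) → (∀ c → t < c → c < j → c ∈ js) →
  ¬ j ∈ av × (∀ c → t < c → c < j → c ∈ av)
unpairedCols-leftmost (c₀ ∷ rest) av j t (c₀> ∷ dec) inc j∈ j≤ full with removeLeftmostGE c₀ av in e
... | just av' = (λ j∈av → proj₁ ih (kept j j∈av (λ { refl → <⇒≱ j<c₀ j≤removed })))
               , (λ c t<c c<j → proj₁ (remaining c (proj₂ ih c t<c c<j)))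
  where
  open LeftmostRemoved (removeLeftmostGE-just c₀ av inc e)
  j<c₀ : j < c₀
  j<c₀ = All.lookup c₀> (unpairedCols-⊆ rest av' j∈)
  ih = unpairedCols-leftmost rest av' j t dec increasing j∈ j≤
         (λ c t<c c<j → Any.tail (λ { refl → <-asym j<c₀ c<j }) (full c t<c c<j))
unpairedCols-leftmost (c₀ ∷ rest) av j t (c₀> ∷ dec) inc (there j∈) j≤ full | nothing =
  unpairedCols-leftmost rest av j t dec inc j∈ (λ x x∈ → j≤ x (there x∈))
    (λ c t<c c<j → Any.tail (λ { refl → <-asym j<c₀ c<j }) (full c t<c c<j))
  where
  j<c₀ : j < c₀
  j<c₀ = All.lookup c₀> (unpairedCols-⊆ rest av j∈)
unpairedCols-leftmost (c₀ ∷ rest) av j t (c₀> ∷ dec) inc (here refl) j≤ full | nothing =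
  (λ j∈av → <-irrefl refl (removeLeftmostGE-nothing j av e j j∈av)) ,
  allPaired-fill rest av j t dec c₀> inc (removeLeftmostGE-nothing j av e)
    (λ x x∈ → <⇒≱ (All.lookup c₀> (unpairedCols-⊆ rest av x∈)) (j≤ x (there x∈)))
    (λ c t<c c<j → Any.tail (λ { refl → <-irrefl refl c<j }) (full c t<c c<j))

rowCols-∈⁻ : ∀ n D r {c} → c ∈ rowCols n D r → 1 ≤ c × c ≤ n × D r c ≡ true
rowCols-∈⁻ n D r c∈ with ∈-filter⁻ (T? ∘ D r) {xs = applyUpTo suc n} c∈
... | c∈upTo , Drc with ∈-applyUpTo⁻ suc c∈upTo
... | k , k<n , refl = s≤s z≤n , k<n , Equivalence.to T-≡ Drc

∈-upTo : ∀ {n c} → 1 ≤ c → c ≤ n → c ∈ applyUpTo suc n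
∈-upTo {c = suc c} _ c<n = ∈-applyUpTo⁺ suc c<n

rowCols-∈⁺ : ∀ n D r {c} → 1 ≤ c → c ≤ n → D r c ≡ true → c ∈ rowCols n D r
rowCols-∈⁺ n D r 1≤c c≤n Drc = ∈-filter⁺ (T? ∘ D r) (∈-upTo 1≤c c≤n) (Equivalence.from T-≡ Drc)

upTo-increasing : ∀ n → Increasing (applyUpTo suc n)
upTo-increasing n = AllPairs.applyUpTo⁺₁ suc n (λ i<j _ → s≤s i<j)

rowCols-increasing : ∀ n D r → Increasing (rowCols n D r)
rowCols-increasing n D r = AllPairs.filter⁺ (T? ∘ D r) (upTo-increasing n)

Between : (ℕ → Bool) → ℕ → ℕ → Set
Between P a j = ∀ c → a < c → c < j → P c ≡ true

module _ (n : ℕ) (D : Diagram) (i : ℕ) {j : ℕ} (lu : leftmostUnpaired n D i ≡ just j) where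

  private
    js = reverse (rowCols n D i)
    av = rowCols n D (suc i)
    leftmost = minimumM-just (unpairedCols js av) lu

  leftmostUnpaired-cross : 1 ≤ j × j ≤ n × D i j ≡ true
  leftmostUnpaired-cross = rowCols-∈⁻ n D i (Any.reverse⁻ (unpairedCols-⊆ js av (proj₁ leftmost)))

  private
    leftmost-spec : ∀ t → Between (D i) t j → ¬ j ∈ av × (∀ c → t < c → c < j → c ∈ av)
    leftmost-spec t rowFull =
      unpairedCols-leftmost js av j t (reverse-decreasing _ (rowCols-increasing n D i)) (rowCols-increasing n D (suc i))
        (proj₁ leftmost) (proj₂ leftmost)
        (λ c t<c c<j → Any.reverse⁺ (rowCols-∈⁺ n D i (≤-trans (s≤s z≤n) t<c) (≤-trans (<⇒≤ c<j) j≤n) (rowFull c t<c c<j)))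
      where j≤n = proj₁ (proj₂ leftmostUnpaired-cross)

  leftmostUnpaired-elbowBelow : D (suc i) j ≡ false
  leftmostUnpaired-elbowBelow with D (suc i) j in e
  ... | false = refl
  ... | true  = contradiction (rowCols-∈⁺ n D (suc i) 1≤j j≤n e)
                  (proj₁ (leftmost-spec j λ c j<c c<j → contradiction c<j (<-asym j<c)))
    where
    1≤j = proj₁ leftmostUnpaired-cross
    j≤n = proj₁ (proj₂ leftmostUnpaired-cross)

  leftmostUnpaired-fillBelow : ∀ t → Between (D i) t j → Between (D (suc i)) t j
  leftmostUnpaired-fillBelow t rowFull c t<c c<j = proj₂ (proj₂ (rowCols-∈⁻ n D (suc i) (proj₂ (leftmost-spec t rowFull) c t<c c<j)))

module _ (D : Diagram) (i j m : ℕ) where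

  chuteMove-target : chuteMove D i j m (suc i) (j ∸ m) ≡ true
  chuteMove-target rewrite ≡ᵇ-refl i | ≡ᵇ-refl (j ∸ m) = refl

  chuteMove-source : chuteMove D i j m i j ≡ false
  chuteMove-source rewrite ≡ᵇ-≢ (≢-sym (1+n≢n {i})) | ≡ᵇ-refl i | ≡ᵇ-refl j = refl

  chuteMove-elsewhere : ∀ r c → ¬ (r ≡ suc i × c ≡ j ∸ m) → ¬ (r ≡ i × c ≡ j) → chuteMove D i j m r c ≡ D r c
  chuteMove-elsewhere r c notTarget notSource with (r ≡ᵇ suc i) ∧ (c ≡ᵇ j ∸ m) in e₁
  ... | true = contradiction ((≡ᵇ-sound (proj₁ (∧-true e₁)) , ≡ᵇ-sound (proj₂ (∧-true e₁)))) notTarget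
  ... | false with (r ≡ᵇ i) ∧ (c ≡ᵇ j) in e₂
  ...   | true  = contradiction ((≡ᵇ-sound (proj₁ (∧-true e₂)) , ≡ᵇ-sound (proj₂ (∧-true e₂)))) notSource
  ...   | false = refl

chuteMove-isPipeDream : ∀ {n D i j m} → IsPipeDream n D → 1 ≤ m → m < j → i + j ≤ n → IsPipeDream n (chuteMove D i j m)
chuteMove-isPipeDream {n} {D} {i} {j} {m} pd 1≤m m<j i+j≤n r c cross
  with (r ≟ suc i) ×-dec (c ≟ j ∸ m)
... | yes (refl , refl) = s≤s z≤n , m<n⇒0<n∸m m<j , (begin
  suc i + (j ∸ m) ≡⟨ +-suc i (j ∸ m) ⟨
  i + suc (j ∸ m) ≤⟨ +-monoʳ-≤ i (∸-monoʳ-< {j} {m} {0} 1≤m (<⇒≤ m<j)) ⟩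
  i + j           ≤⟨ i+j≤n ⟩
  n               ∎)
  where open ≤-Reasoning
... | no notTarget with (r ≟ i) ×-dec (c ≟ j)
...   | yes (refl , refl) = contradiction (trans (sym cross) (chuteMove-source D i j m)) λ ()
...   | no notSource = pd r c (trans (sym (chuteMove-elsewhere D i j m r c notTarget notSource)) cross)

rowCount-toggle : ∀ n (E E' : Diagram) r c → 1 ≤ c → c ≤ n → (∀ c' → c' ≢ c → E r c' ≡ E' r c') →
  E r c ≡ false → E' r c ≡ true → length (rowCols n E' r) ≡ suc (length (rowCols n E r))
rowCount-toggle n E E' r c 1≤c c≤n agree = length-filterᵇ-toggle (E r) (E' r) (applyUpTo suc n)
  (AllPairs.map <⇒≢ (upTo-increasing n)) (∈-upTo 1≤c c≤n) agree

wt-chuteMove : ∀ n D i j m → 1 ≤ m → m < j → j ≤ n → D i j ≡ true → D (suc i) (j ∸ m) ≡ false →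
  ∀ r → wt n (chuteMove D i j m) r ≡ wt n D r - alpha i r
wt-chuteMove n D i j m 1≤m m<j j≤n source target r with r ≟ i
... | yes refl rewrite rowCount-toggle n (chuteMove D r j m) D r j (≤-trans (s≤s z≤n) m<j) j≤n
      (λ c c≢j → chuteMove-elsewhere D r j m r c (λ { (r≡1+r , _) → 1+n≢n (sym r≡1+r) }) (λ { (_ , c≡j) → c≢j c≡j }))
      (chuteMove-source D r j m) source
  | ≡ᵇ-refl r = refl
... | no r≢i with r ≟ suc i
...   | yes refl rewrite rowCount-toggle n D (chuteMove D i j m) (suc i) (j ∸ m) (m<n⇒0<n∸m m<j) (≤-trans (m∸n≤m j m) j≤n)
      (λ c c≢ → sym (chuteMove-elsewhere D i j m (suc i) c (λ { (_ , c≡) → c≢ c≡ }) (λ { (1+i≡i , _) → 1+n≢n 1+i≡i })))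
      target (chuteMove-target D i j m)
  | ≡ᵇ-≢ (1+n≢n {i}) | ≡ᵇ-refl i = cong +_ (+-comm 1 _)
...   | no r≢1+i rewrite filterᵇ-cong (chuteMove D i j m r) (D r) (applyUpTo suc n)
      (λ c _ → chuteMove-elsewhere D i j m r c (λ { (r≡1+i , _) → r≢1+i r≡1+i }) (λ { (r≡i , _) → r≢i r≡i }))
  | ≡ᵇ-≢ r≢i | ≡ᵇ-≢ r≢1+i = cong +_ (sym (+-identityʳ _))

-- The cross at (i, suc w + a) is to be moved to (i+1, a); w counts the columns strictly between.
record Chute (D : Diagram) (i a w : ℕ) : Set where
  field
    cross-right  : D i (suc w + a) ≡ true
    elbow-left   : D i a ≡ false
    elbow-below  : D (suc i) (suc w + a) ≡ false
    full-top     : ∀ t → t < w → D i (suc t + a) ≡ true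
    full-bottom  : ∀ t → t < w → D (suc i) (suc t + a) ≡ true

  runTop : Path D (state i (suc a) fromLeft) (state i (suc w + a) fromLeft)
  runTop = crossRun i a w full-top

  runBottom : Path D (state (suc i) (suc a) fromLeft) (state (suc i) (suc w + a) fromLeft)
  runBottom = crossRun (suc i) a w full-bottom

PipesExit : ℕ → Diagram → Set
PipesExit n D = ∀ p → 1 ≤ p → p ≤ n → ∃ λ e → exitCol n D p ≡ just e

∈-pipeCrosses : ∀ n D p {x} → x ∈ proj₁ (pipe n D p) → D (proj₁ x) (proj₂ x) ≡ true → x ∈ pipeCrosses n D p
∈-pipeCrosses n D p x∈ cross = ∈-filter⁺ (λ b → T? (D (proj₁ b) (proj₂ b))) x∈ (Equivalence.from T-≡ cross)

module _ {n : ℕ} {D : Diagram} {s : State} (P : PipeThrough n D s) (exits : PipesExit n D) where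
  open PipeThrough P

  pipe-visits-path : ∀ {t x} (ρ : Path D s t) → x ∈ pathBoxes ρ → x ∈ proj₁ (pipe n D start)
  pipe-visits-path {x = x} ρ x∈ρ with pipe-prefix {n} (route ◅◅ ρ) (proj₂ (exits start 1≤start start≤n))
  ... | rest , pipe≡ = subst (x ∈_) (sym pipe≡)
    (∈-++⁺ˡ (subst (x ∈_) (sym (pathBoxes-◅◅ route ρ)) (∈-++⁺ʳ (pathBoxes route) x∈ρ)))

  pipe-visits-end : ∀ {t} (ρ : Path D s t) → box t ∈ proj₁ (pipe n D start)
  pipe-visits-end {t} ρ with pipe-prefix {n} (route ◅◅ ρ) (proj₂ (exits start 1≤start start≤n))
  ... | rest , pipe≡ = subst (box t ∈_) (sym pipe≡) (∈-++⁺ʳ (pathBoxes (route ◅◅ ρ)) (here refl))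

pipeThrough-distinct : ∀ {n D r c} (P : PipeThrough n D (state r c fromBottom)) (Q : PipeThrough n D (state r c fromLeft)) →
  PipeThrough.start P ≢ PipeThrough.start Q
pipeThrough-distinct (pipeThrough p _ _ π) (pipeThrough .p _ _ ρ) refl with paths-comparable π ρ
... | inj₁ loop = contradiction (path-noLoop loop) λ ()
... | inj₂ loop = contradiction (path-noLoop loop) λ ()

2≤crossCount : ∀ n D r r' {x y} → x ≢ y → x ∈ pipeCrosses n D r → y ∈ pipeCrosses n D r →
  x ∈ pipeCrosses n D r' → y ∈ pipeCrosses n D r' → 2 ≤ crossCount n D r r'
2≤crossCount n D r r' x≢y x∈r y∈r x∈r' y∈r' =
  2≤length-filterᵇ (λ b → elemBox b (pipeCrosses n D r')) _ x∈r y∈r x≢y (elemBox-complete x∈r') (elemBox-complete y∈r')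

reduced-noDoubleCrossing : ∀ n D {p q x y} → IsReduced n D → 1 ≤ p → p ≤ n → 1 ≤ q → q ≤ n → p ≢ q → x ≢ y →
  x ∈ pipeCrosses n D p → y ∈ pipeCrosses n D p → x ∈ pipeCrosses n D q → y ∈ pipeCrosses n D q → ⊥
reduced-noDoubleCrossing n D {p} {q} reduced 1≤p p≤n 1≤q q≤n p≢q x≢y x∈p y∈p x∈q y∈q with <-cmp p q
... | tri< p<q _ _ = <⇒≱ (2≤crossCount n D p q x≢y x∈p y∈p x∈q y∈q) (reduced p q 1≤p p<q q≤n)
... | tri≈ _ p≡q _ = p≢q p≡q
... | tri> _ _ q<p = <⇒≱ (2≤crossCount n D q p x≢y x∈q y∈q x∈p y∈p) (reduced q p 1≤q q<p p≤n)

chute-elbow-corner : ∀ {n D i a w} → IsPipeDream n D → IsReduced n D → PipesExit n D → 1 ≤ a →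
  Chute D (suc i) a w → D (suc (suc i)) a ≡ false
chute-elbow-corner {n} {D} {i} {suc a'} {w} pd reduced exits (s≤s z≤n) chute with D (suc (suc i)) (suc a') in corner
... | false = refl
... | true = ⊥-elim (reduced-noDoubleCrossing n D reduced (1≤start up) (start≤n up) (1≤start across) (start≤n across)
                       (pipeThrough-distinct up across) X≢Y X∈up Y∈up X∈across Y∈across)
  where
  open Chute chute
  open PipeThrough
  a = suc a'
  X Y : ℕ × ℕ
  X = suc i , suc w + a
  Y = suc (suc i) , a

  X≢Y : X ≢ Y
  X≢Y X≡Y = 1+n≢n (sym (cong proj₁ X≡Y))

  bound : suc (suc i) + a ≤ n
  bound = proj₂ (proj₂ (pd _ _ corner))

  up : PipeThrough n D (state (suc (suc i)) a fromBottom)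
  up = pipeThrough-fromBottom pd (suc (suc i)) a' (s≤s z≤n) bound

  across : PipeThrough n D (state (suc (suc i)) a fromLeft)
  across = pipeThrough-fromLeft pd (suc (suc i)) a' (s≤s z≤n) (≤-trans (+-monoʳ-≤ (suc (suc i)) (n≤1+n a')) bound)

  upRoute : Path D (state (suc (suc i)) a fromBottom) (state (suc i) (suc (suc w + a)) fromLeft)
  upRoute = passUp corner ◅ turnRight elbow-left ◅ (runTop ◅◅ passRight cross-right ◅ ε)

  acrossRoute : Path D (state (suc (suc i)) a fromLeft) (state (suc i) (suc w + a) fromBottom)
  acrossRoute = passRight corner ◅ (runBottom ◅◅ turnUp elbow-below ◅ ε)

  X∈upRoute : X ∈ pathBoxes upRoute
  X∈upRoute = there (there (subst (X ∈_) (sym (pathBoxes-◅◅ runTop _)) (∈-++⁺ʳ (pathBoxes runTop) (here refl))))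

  X∈up : X ∈ pipeCrosses n D (start up)
  X∈up = ∈-pipeCrosses n D _ (pipe-visits-path up exits upRoute X∈upRoute) cross-right
  Y∈up : Y ∈ pipeCrosses n D (start up)
  Y∈up = ∈-pipeCrosses n D _ (pipe-visits-path up exits upRoute (here refl)) corner
  X∈across : X ∈ pipeCrosses n D (start across)
  X∈across = ∈-pipeCrosses n D _ (pipe-visits-end across exits acrossRoute) cross-right
  Y∈across : Y ∈ pipeCrosses n D (start across)
  Y∈across = ∈-pipeCrosses n D _ (pipe-visits-path across exits acrossRoute (here refl)) corner

-- Moving the cross along a chute

module ChuteExchange
  (n : ℕ) {D D' : Diagram} {i₀ a w : ℕ} (1≤a : 1 ≤ a) (chute : Chute D (suc i₀) a w)
  (elbow-corner : D (suc (suc i₀)) a ≡ false)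
  (D'-corner : D' (suc (suc i₀)) a ≡ true)
  (D'-right : D' (suc i₀) (suc w + a) ≡ false)
  (D'-elsewhere : ∀ r c → ¬ (r ≡ suc (suc i₀) × c ≡ a) → ¬ (r ≡ suc i₀ × c ≡ suc w + a) → D' r c ≡ D r c)
  where

  open Chute chute

  i j : ℕ
  i = suc i₀
  j = suc w + a

  a<j : a < j
  a<j = s≤s (m≤n+m a w)

  between : ℕ → Bool
  between c = (a <ᵇ c) ∧ (c <ᵇ j)

  -- σ sends the crosses met by a pipe of D to those met by the same pipe of D': it swaps rows i and
  -- i+1 strictly between columns a and j, and swaps the moved cross (i, j) with its target (i+1, a).
  σ : ℕ × ℕ → ℕ × ℕ
  σ (r , c) =
    if between c then (if r ≡ᵇ i then (suc i , c) else (if r ≡ᵇ suc i then (i , c) else (r , c)))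
    else (if (r ≡ᵇ i) ∧ (c ≡ᵇ j) then (suc i , a) else (if (r ≡ᵇ suc i) ∧ (c ≡ᵇ a) then (i , j) else (r , c)))

  between-true : ∀ {c} → a < c → c < j → between c ≡ true
  between-true a<c c<j rewrite <ᵇ-complete a<c | <ᵇ-complete c<j = refl

  σ-top : ∀ {c} → a < c → c < j → σ (i , c) ≡ (suc i , c)
  σ-top a<c c<j rewrite between-true a<c c<j | ≡ᵇ-refl i = refl

  σ-bottom : ∀ {c} → a < c → c < j → σ (suc i , c) ≡ (i , c)
  σ-bottom a<c c<j rewrite between-true a<c c<j | ≡ᵇ-≢ (1+n≢n {i}) | ≡ᵇ-refl i = refl

  σ-right : σ (i , j) ≡ (suc i , a)
  σ-right rewrite <ᵇ-complete a<j | <ᵇ-≮ (<-irrefl {j} refl) | ≡ᵇ-refl i | ≡ᵇ-refl j = refl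

  σ-corner : σ (suc i , a) ≡ (i , j)
  σ-corner rewrite <ᵇ-≮ (<-irrefl {a} refl) | ≡ᵇ-≢ (1+n≢n {i}) | ≡ᵇ-refl i | ≡ᵇ-refl a = refl

  InChute : ℕ → ℕ → Set
  InChute r c = (r ≡ i ⊎ r ≡ suc i) × a ≤ c × c ≤ j

  inChute? : ∀ r c → Dec (InChute r c)
  inChute? r c = ((r ≟ i) ⊎-dec (r ≟ suc i)) ×-dec ((a ≤? c) ×-dec (c ≤? j))

  data BoxView (r c : ℕ) : Set where
    top    : a < c → c < j → r ≡ i → BoxView r c
    bottom : a < c → c < j → r ≡ suc i → BoxView r c
    right  : r ≡ i → c ≡ j → BoxView r c
    corner : r ≡ suc i → c ≡ a → BoxView r c
    fixed  : σ (r , c) ≡ (r , c) → BoxView r c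

  boxView : ∀ r c → BoxView r c
  boxView r c with between c in b
  ... | true with r ≡ᵇ i in e₁
  ...   | true = top (<ᵇ-sound (proj₁ (∧-true b))) (<ᵇ-sound (proj₂ (∧-true b))) (≡ᵇ-sound e₁)
  ...   | false with r ≡ᵇ suc i in e₂
  ...     | true  = bottom (<ᵇ-sound (proj₁ (∧-true b))) (<ᵇ-sound (proj₂ (∧-true b))) (≡ᵇ-sound e₂)
  ...     | false = fixed (fixedBetween b e₁ e₂)
    where
    fixedBetween : between c ≡ true → (r ≡ᵇ i) ≡ false → (r ≡ᵇ suc i) ≡ false → σ (r , c) ≡ (r , c)
    fixedBetween b e₁ e₂ rewrite b | e₁ | e₂ = refl
  boxView r c | false with (r ≡ᵇ i) ∧ (c ≡ᵇ j) in e₁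
  ...   | true = right (≡ᵇ-sound (proj₁ (∧-true e₁))) (≡ᵇ-sound (proj₂ (∧-true e₁)))
  ...   | false with (r ≡ᵇ suc i) ∧ (c ≡ᵇ a) in e₂
  ...     | true  = corner (≡ᵇ-sound (proj₁ (∧-true e₂))) (≡ᵇ-sound (proj₂ (∧-true e₂)))
  ...     | false = fixed (fixedElsewhere b e₁ e₂)
    where
    fixedElsewhere : between c ≡ false → (r ≡ᵇ i) ∧ (c ≡ᵇ j) ≡ false → (r ≡ᵇ suc i) ∧ (c ≡ᵇ a) ≡ false →
      σ (r , c) ≡ (r , c)
    fixedElsewhere b e₁ e₂ rewrite b | e₁ | e₂ = refl

  σ-outside : ∀ r c → ¬ InChute r c → σ (r , c) ≡ (r , c)
  σ-outside r c out with boxView r c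
  ... | top a<c c<j r≡i      = contradiction (inj₁ r≡i , <⇒≤ a<c , <⇒≤ c<j) out
  ... | bottom a<c c<j r≡1+i = contradiction (inj₂ r≡1+i , <⇒≤ a<c , <⇒≤ c<j) out
  ... | right refl refl      = contradiction (inj₁ refl , <⇒≤ a<j , ≤-refl) out
  ... | corner refl refl     = contradiction (inj₂ refl , ≤-refl , <⇒≤ a<j) out
  ... | fixed σ≡             = σ≡

  σ-involutive : ∀ b → σ (σ b) ≡ b
  σ-involutive (r , c) with boxView r c
  ... | top a<c c<j refl    rewrite σ-top a<c c<j    = σ-bottom a<c c<j
  ... | bottom a<c c<j refl rewrite σ-bottom a<c c<j = σ-top a<c c<j
  ... | right refl refl     rewrite σ-right          = σ-corner
  ... | corner refl refl    rewrite σ-corner         = σ-right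
  ... | fixed σ≡            rewrite σ≡               = σ≡

  σ-injective : ∀ {x y} → σ x ≡ σ y → x ≡ y
  σ-injective {x} {y} σx≡σy = trans (sym (σ-involutive x)) (trans (cong σ σx≡σy) (σ-involutive y))

  D'-outside : ∀ {r c} → ¬ InChute r c → D' r c ≡ D r c
  D'-outside out = D'-elsewhere _ _ (λ { (refl , refl) → out (inj₂ refl , ≤-refl , <⇒≤ a<j) })
                                    (λ { (refl , refl) → out (inj₁ refl , <⇒≤ a<j , ≤-refl) })

  D'-left : D' i a ≡ false
  D'-left = trans (D'-elsewhere _ _ (λ { (i≡1+i , _) → 1+n≢n (sym i≡1+i) }) (λ { (_ , a≡j) → <-irrefl a≡j a<j })) elbow-left

  D'-below : D' (suc i) j ≡ false
  D'-below = trans (D'-elsewhere _ _ (λ { (_ , j≡a) → <-irrefl (sym j≡a) a<j }) (λ { (1+i≡i , _) → 1+n≢n 1+i≡i })) elbow-below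

  D'-full-top : ∀ t → t < w → D' i (suc t + a) ≡ true
  D'-full-top t t<w = trans (D'-elsewhere _ _ (λ { (i≡1+i , _) → 1+n≢n (sym i≡1+i) })
                                               (λ { (_ , c≡j) → <-irrefl c≡j (s≤s (+-monoˡ-< a t<w)) }))
                            (full-top t t<w)

  D'-full-bottom : ∀ t → t < w → D' (suc i) (suc t + a) ≡ true
  D'-full-bottom t t<w = trans (D'-elsewhere _ _ (λ { (_ , c≡a) → <-irrefl (sym c≡a) (s≤s (m≤n+m a t)) })
                                                  (λ { (1+i≡i , _) → 1+n≢n 1+i≡i }))
                               (full-bottom t t<w)

  X Y Z : ℕ × ℕ
  X = i , j
  Y = suc i , a
  Z = suc i , j

  inside : ∀ {t} → t < w → a < suc t + a × suc t + a < j
  inside {t} t<w = s≤s (m≤n+m a t) , s≤s (+-monoˡ-< a t<w)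

  map-σ-top : map σ (rowSegment i a w) ≡ rowSegment (suc i) a w
  map-σ-top = trans (map-applyUpTo _ σ w)
    (applyUpTo-cong _ _ w (λ t t<w → σ-top (proj₁ (inside t<w)) (proj₂ (inside t<w))))

  map-σ-bottom : map σ (rowSegment (suc i) a w) ≡ rowSegment i a w
  map-σ-bottom = trans (map-applyUpTo _ σ w)
    (applyUpTo-cong _ _ w (λ t t<w → σ-bottom (proj₁ (inside t<w)) (proj₂ (inside t<w))))

  Matches : List (ℕ × ℕ) × Maybe ℕ → List (ℕ × ℕ) × Maybe ℕ → Set
  Matches (l , e) (l' , e') = e ≡ e' × crossesOn D' l' ↭ map σ (crossesOn D l)

  matches-prepend : ∀ bs bs' x x' → Matches x x' → crossesOn D' bs' ↭ map σ (crossesOn D bs) →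
    Matches (prepend bs x) (prepend bs' x')
  matches-prepend bs bs' (l , e) (l' , e') (e≡e' , l↭) bs↭ = e≡e' ,
    ↭-trans (↭-reflexive (crossesOn-++ D' bs' l'))
      (↭-trans (++⁺ bs↭ l↭)
        (↭-reflexive (trans (sym (map-++ σ (crossesOn D bs) (crossesOn D l))) (cong (map σ) (sym (crossesOn-++ D bs l))))))

  matches-cross : ∀ {r c} x x' → Matches x x' → D r c ≡ true → D' r c ≡ true → σ (r , c) ≡ (r , c) →
    Matches (addBox r c x) (addBox r c x')
  matches-cross x x' m cross cross' σ-fixed = matches-prepend [ _ ] [ _ ] x x' m
    (↭-reflexive (trans (crossesOn-cross D' [] cross') (sym (trans (cong (map σ) (crossesOn-cross D [] cross)) (cong [_] σ-fixed)))))

  matches-elbow : ∀ {r c} x x' → Matches x x' → D r c ≡ false → D' r c ≡ false → Matches (addBox r c x) (addBox r c x')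
  matches-elbow x x' m elbow elbow' = matches-prepend [ _ ] [ _ ] x x' m
    (↭-reflexive (trans (crossesOn-elbow D' [] elbow') (sym (cong (map σ) (crossesOn-elbow D [] elbow)))))

  matches-resp : ∀ {x x' y y'} → x ≡ y → x' ≡ y' → Matches y y' → Matches x x'
  matches-resp refl refl m = m

  runTop' : Path D' (state i (suc a) fromLeft) (state i j fromLeft)
  runTop' = crossRun i a w D'-full-top

  runBottom' : Path D' (state (suc i) (suc a) fromLeft) (state (suc i) j fromLeft)
  runBottom' = crossRun (suc i) a w D'-full-bottom

  cornerAcross : Path D (state (suc i) a fromLeft) (state i (suc j) fromLeft)
  cornerAcross = turnUp elbow-corner ◅ turnRight elbow-left ◅ (runTop ◅◅ passRight cross-right ◅ ε)

  cornerAcross' : Path D' (state (suc i) a fromLeft) (state i (suc j) fromLeft)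
  cornerAcross' = passRight D'-corner ◅ (runBottom' ◅◅ turnUp D'-below ◅ turnRight D'-right ◅ ε)

  cornerUp : Path D (state (suc i) a fromBottom) (state i j fromBottom)
  cornerUp = turnRight elbow-corner ◅ (runBottom ◅◅ turnUp elbow-below ◅ ε)

  cornerUp' : Path D' (state (suc i) a fromBottom) (state i j fromLeft)
  cornerUp' = passUp D'-corner ◅ turnRight D'-left ◅ runTop'

  pathLength-run-◅◅ : ∀ {E r} (full : ∀ t → t < w → E r (suc t + a) ≡ true) {t} (q : Path E (state r j fromLeft) t) →
    pathLength (crossRun {E} r a w full ◅◅ q) ≡ w + pathLength q
  pathLength-run-◅◅ {E} {r} full q =
    trans (pathLength-◅◅ (crossRun {E} r a w full) q) (cong (_+ pathLength q) (pathLength-crossRun {E} r a w full))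

  cornerAcross-length : pathLength cornerAcross ≡ 3 + w
  cornerAcross-length = cong (suc ∘ suc) (trans (pathLength-run-◅◅ full-top _) (+-comm w 1))

  cornerAcross'-length : pathLength cornerAcross' ≡ 3 + w
  cornerAcross'-length = cong suc (trans (pathLength-run-◅◅ D'-full-bottom _) (+-comm w 2))

  cornerUp-length : pathLength cornerUp ≡ 2 + w
  cornerUp-length = cong suc (trans (pathLength-run-◅◅ full-bottom _) (+-comm w 1))

  cornerUp'-length : pathLength cornerUp' ≡ 2 + w
  cornerUp'-length = cong (suc ∘ suc) (pathLength-crossRun {D'} i a w D'-full-top)

  cornerAcross-crosses : crossesOn D' (pathBoxes cornerAcross') ↭ map σ (crossesOn D (pathBoxes cornerAcross))
  cornerAcross-crosses = ↭-trans (↭-reflexive crosses') (↭-trans (∷↭∷ʳ Y (rowSegment (suc i) a w)) (↭-reflexive (sym crosses)))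
    where
    open ≡-Reasoning
    crosses' : crossesOn D' (pathBoxes cornerAcross') ≡ Y ∷ rowSegment (suc i) a w
    crosses' = begin
      crossesOn D' (Y ∷ pathBoxes (runBottom' ◅◅ _))                   ≡⟨ crossesOn-cross D' _ D'-corner ⟩
      Y ∷ crossesOn D' (pathBoxes (runBottom' ◅◅ _))                   ≡⟨ cong (λ bs → Y ∷ crossesOn D' bs) (pathBoxes-◅◅ runBottom' _) ⟩
      Y ∷ crossesOn D' (pathBoxes runBottom' ++ Z ∷ X ∷ [])            ≡⟨ cong (Y ∷_) (crossesOn-crossRun D' (suc i) a w D'-full-bottom _) ⟩
      Y ∷ (rowSegment (suc i) a w ++ crossesOn D' (Z ∷ X ∷ []))        ≡⟨ cong (λ l → Y ∷ (rowSegment (suc i) a w ++ l))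
                                                                            (trans (crossesOn-elbow D' _ D'-below) (crossesOn-elbow D' [] D'-right)) ⟩
      Y ∷ (rowSegment (suc i) a w ++ [])                               ≡⟨ cong (Y ∷_) (++-identityʳ _) ⟩
      Y ∷ rowSegment (suc i) a w                                       ∎
    crosses : map σ (crossesOn D (pathBoxes cornerAcross)) ≡ rowSegment (suc i) a w ++ [ Y ]
    crosses = begin
      map σ (crossesOn D (Y ∷ (i , a) ∷ pathBoxes (runTop ◅◅ _)))      ≡⟨ cong (map σ) (trans (crossesOn-elbow D _ elbow-corner) (crossesOn-elbow D _ elbow-left)) ⟩
      map σ (crossesOn D (pathBoxes (runTop ◅◅ _)))                    ≡⟨ cong (map σ ∘ crossesOn D) (pathBoxes-◅◅ runTop _) ⟩
      map σ (crossesOn D (pathBoxes runTop ++ [ X ]))                  ≡⟨ cong (map σ) (crossesOn-crossRun D i a w full-top _) ⟩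
      map σ (rowSegment i a w ++ crossesOn D [ X ])                    ≡⟨ cong (λ l → map σ (rowSegment i a w ++ l)) (crossesOn-cross D [] cross-right) ⟩
      map σ (rowSegment i a w ++ [ X ])                                ≡⟨ map-++ σ (rowSegment i a w) [ X ] ⟩
      map σ (rowSegment i a w) ++ [ σ X ]                              ≡⟨ cong₂ (λ l b → l ++ [ b ]) map-σ-top σ-right ⟩
      rowSegment (suc i) a w ++ [ Y ]                                  ∎

  cornerUp-crosses : crossesOn D' (pathBoxes cornerUp' ++ [ X ]) ↭ map σ (crossesOn D (pathBoxes cornerUp ++ [ X ]))
  cornerUp-crosses = ↭-trans (↭-reflexive crosses') (↭-trans (∷↭∷ʳ Y (rowSegment i a w)) (↭-reflexive (sym crosses)))
    where
    open ≡-Reasoning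
    crosses' : crossesOn D' (pathBoxes cornerUp' ++ [ X ]) ≡ Y ∷ rowSegment i a w
    crosses' = begin
      crossesOn D' (Y ∷ (i , a) ∷ (pathBoxes runTop' ++ [ X ]))  ≡⟨ crossesOn-cross D' _ D'-corner ⟩
      Y ∷ crossesOn D' ((i , a) ∷ (pathBoxes runTop' ++ [ X ]))  ≡⟨ cong (Y ∷_) (crossesOn-elbow D' _ D'-left) ⟩
      Y ∷ crossesOn D' (pathBoxes runTop' ++ [ X ])              ≡⟨ cong (Y ∷_) (crossesOn-crossRun D' i a w D'-full-top _) ⟩
      Y ∷ (rowSegment i a w ++ crossesOn D' [ X ])               ≡⟨ cong (λ l → Y ∷ (rowSegment i a w ++ l)) (crossesOn-elbow D' [] D'-right) ⟩
      Y ∷ (rowSegment i a w ++ [])                               ≡⟨ cong (Y ∷_) (++-identityʳ _) ⟩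
      Y ∷ rowSegment i a w                                       ∎
    crosses : map σ (crossesOn D (pathBoxes cornerUp ++ [ X ])) ≡ rowSegment i a w ++ [ Y ]
    crosses = begin
      map σ (crossesOn D (Y ∷ (pathBoxes (runBottom ◅◅ _) ++ [ X ])))  ≡⟨ cong (map σ) (crossesOn-elbow D _ elbow-corner) ⟩
      map σ (crossesOn D (pathBoxes (runBottom ◅◅ _) ++ [ X ]))        ≡⟨ cong (λ bs → map σ (crossesOn D (bs ++ [ X ]))) (pathBoxes-◅◅ runBottom _) ⟩
      map σ (crossesOn D ((pathBoxes runBottom ++ [ Z ]) ++ [ X ]))    ≡⟨ cong (map σ ∘ crossesOn D) (++-assoc (pathBoxes runBottom) [ Z ] [ X ]) ⟩
      map σ (crossesOn D (pathBoxes runBottom ++ Z ∷ X ∷ []))          ≡⟨ cong (map σ) (crossesOn-crossRun D (suc i) a w full-bottom _) ⟩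
      map σ (rowSegment (suc i) a w ++ crossesOn D (Z ∷ X ∷ []))       ≡⟨ cong (λ l → map σ (rowSegment (suc i) a w ++ l))
                                                                            (trans (crossesOn-elbow D _ elbow-below) (crossesOn-cross D [] cross-right)) ⟩
      map σ (rowSegment (suc i) a w ++ [ X ])                          ≡⟨ map-++ σ (rowSegment (suc i) a w) [ X ] ⟩
      map σ (rowSegment (suc i) a w) ++ [ σ X ]                        ≡⟨ cong₂ (λ l b → l ++ [ b ]) map-σ-bottom σ-right ⟩
      rowSegment i a w ++ [ Y ]                                        ∎

  -- The states at which traces of D and D' are compared: outside the chute, or entering it from the
  -- left or from below.
  data Entry : State → Set where
    outside    : ∀ {r c d} → ¬ InChute r c → Entry (state r c d)
    topLeft    : Entry (state i a fromLeft)
    cornerLeft : Entry (state (suc i) a fromLeft)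
    fromBelow  : ∀ k → k ≤ suc w → Entry (state (suc i) (k + a) fromBottom)

  entry-right : ∀ {r c} → ¬ InChute r c → Entry (state r (suc c) fromLeft)
  entry-right {r} {c} out with inChute? r (suc c)
  ... | no out' = outside out'
  ... | yes (row , a≤1+c , 1+c≤j) with a ≤? c
  ...   | yes a≤c = contradiction (row , a≤c , ≤-trans (n≤1+n c) 1+c≤j) out
  ...   | no a≰c with ≤-antisym a≤1+c (≰⇒> a≰c) | row
  ...     | refl | inj₁ refl = topLeft
  ...     | refl | inj₂ refl = cornerLeft

  entry-up : ∀ {r c} → ¬ InChute (suc (suc r)) c → Entry (state (suc r) c fromBottom)
  entry-up {r} {c} out with inChute? (suc r) c
  ... | no out' = outside out'
  ... | yes (inj₁ 1+r≡i , a≤c , c≤j) = contradiction (inj₂ (cong suc 1+r≡i) , a≤c , c≤j) out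
  ... | yes (inj₂ refl , a≤c , c≤j) = subst (λ c → Entry (state (suc i) c fromBottom)) (m∸n+n≡m a≤c)
          (fromBelow (c ∸ a) (subst (c ∸ a ≤_) (m+n∸n≡m (suc w) a) (∸-monoˡ-≤ a c≤j)))

  entry-aboveTop : ∀ {r c} → i ≡ suc (suc r) → Entry (state (suc r) c fromBottom)
  entry-aboveTop refl = outside λ { (inj₁ r≡i , _) → 1+n≢n (sym r≡i) ; (inj₂ r≡1+i , _) → m≢1+n+m _ {1} r≡1+i }

  pastRight : ∀ {r} → ¬ InChute r (suc j)
  pastRight (_ , _ , 1+j≤j) = <-irrefl refl 1+j≤j

  entry-start : ∀ p → Entry (state p 1 fromLeft)
  entry-start p with inChute? p 1
  ... | no out = outside out
  ... | yes (inj₁ refl , a≤1 , _) = subst (λ c → Entry (state i c fromLeft)) (≤-antisym a≤1 1≤a) topLeft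
  ... | yes (inj₂ refl , a≤1 , _) = subst (λ c → Entry (state (suc i) c fromLeft)) (≤-antisym a≤1 1≤a) cornerLeft

  remainingFuel< : ∀ {f N} l g → f ≡ suc l + g → f < suc N → g < N
  remainingFuel< l g refl (s≤s f≤N) = <-≤-trans (s≤s (m≤n+m g l)) f≤N

  -- N only bounds the fuel: a route through the corner consumes several steps of fuel at once.
  mutual
    matches-trace : ∀ N f → f < N → ∀ s → Entry s → ∀ {e} → proj₂ (traceFrom f D s) ≡ just e →
      Matches (traceFrom f D s) (traceFrom f D' s)
    matches-trace N zero _ (state r c d) _ ex = contradiction ex λ ()
    matches-trace (suc N) (suc f) (s≤s f<N) (state r c fromLeft) (outside out) ex rewrite D'-outside out with D r c in tile
    ... | true  = matches-cross _ _ (matches-trace N f f<N (state r (suc c) fromLeft) (entry-right out) ex)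
                    tile (trans (D'-outside out) tile) (σ-outside r c out)
    ... | false = matches-elbow _ _ (matches-goUp N f f<N r c (λ { _ refl → entry-up out }) ex) tile (trans (D'-outside out) tile)
    matches-trace (suc N) (suc f) (s≤s f<N) (state r c fromBottom) (outside out) ex rewrite D'-outside out with D r c in tile
    ... | true  = matches-cross _ _ (matches-goUp N f f<N r c (λ { _ refl → entry-up out }) ex)
                    tile (trans (D'-outside out) tile) (σ-outside r c out)
    ... | false = matches-elbow _ _ (matches-trace N f f<N (state r (suc c) fromLeft) (entry-right out) ex) tile (trans (D'-outside out) tile)
    matches-trace (suc N) (suc f) (s≤s f<N) _ topLeft ex =
      matches-resp (trace-elbow-fromLeft D f i a elbow-left) (trace-elbow-fromLeft D' f i a D'-left)
        (matches-elbow _ _ (matches-goUp N f f<N i a (λ _ → entry-aboveTop)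
          (trans (cong proj₂ (sym (trace-elbow-fromLeft D f i a elbow-left))) ex)) elbow-left D'-left)
    matches-trace N f f<N _ cornerLeft ex = matches-cornerAcross N f f<N ex
    matches-trace N f f<N _ (fromBelow zero _) ex = matches-cornerUp N f f<N ex
    matches-trace N f f<N _ (fromBelow (suc k) k≤w) ex with k <? w
    ... | yes k<w = matches-column N f f<N k k<w ex
    ... | no k≮w with ≤-antisym (≤-pred k≤w) (≮⇒≥ k≮w)
    ...   | refl = matches-belowRight N f f<N ex

    matches-goUp : ∀ N f → f < N → ∀ r c → (∀ r' → r ≡ suc (suc r') → Entry (state (suc r') c fromBottom)) →
      ∀ {e} → proj₂ (goUp f D r c) ≡ just e → Matches (goUp f D r c) (goUp f D' r c)
    matches-goUp N f f<N zero          c _     ()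
    matches-goUp N f f<N (suc zero)    c _     ex = refl , ↭-refl
    matches-goUp N f f<N (suc (suc r)) c entry ex = matches-trace N f f<N (state (suc r) c fromBottom) (entry r refl) ex

    matches-belowRight : ∀ N f → f < N → ∀ {e} → proj₂ (traceFrom f D (state (suc i) j fromBottom)) ≡ just e →
      Matches (traceFrom f D (state (suc i) j fromBottom)) (traceFrom f D' (state (suc i) j fromBottom))
    matches-belowRight N zero _ ex = contradiction ex λ ()
    matches-belowRight (suc N) (suc f) (s≤s f<N) ex =
      matches-resp (trace-elbow-fromBottom D f (suc i) j elbow-below) (trace-elbow-fromBottom D' f (suc i) j D'-below)
        (matches-elbow _ _ (matches-trace N f f<N (state (suc i) (suc j) fromLeft) (outside pastRight)
          (trans (cong proj₂ (sym (trace-elbow-fromBottom D f (suc i) j elbow-below))) ex)) elbow-below D'-below)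

    matches-column : ∀ N f → f < N → ∀ k → k < w →
      ∀ {e} → proj₂ (traceFrom f D (state (suc i) (suc k + a) fromBottom)) ≡ just e →
      Matches (traceFrom f D (state (suc i) (suc k + a) fromBottom)) (traceFrom f D' (state (suc i) (suc k + a) fromBottom))
    matches-column N zero _ k k<w ex = contradiction ex λ ()
    matches-column N (suc zero) _ k k<w ex =
      contradiction (trans (cong proj₂ (sym (trace-cross-fromBottom D 0 (suc i) (suc k + a) (full-bottom k k<w)))) ex) λ ()
    matches-column (suc N) (suc (suc f)) (s≤s f<N) k k<w ex =
      matches-resp trace≡ trace≡'
        (matches-prepend column column _ _
          (matches-goUp N f (≤-trans (n≤1+n _) f<N) i c (λ _ → entry-aboveTop) (trans (cong proj₂ (sym trace≡)) ex)) column-crosses)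
      where
      c = suc k + a
      column = (suc i , c) ∷ (i , c) ∷ []
      trace≡ : traceFrom (suc (suc f)) D (state (suc i) c fromBottom) ≡ prepend column (goUp f D i c)
      trace≡ = trans (trace-cross-fromBottom D (suc f) (suc i) c (full-bottom k k<w))
                     (cong (addBox (suc i) c) (trace-cross-fromBottom D f i c (full-top k k<w)))
      trace≡' : traceFrom (suc (suc f)) D' (state (suc i) c fromBottom) ≡ prepend column (goUp f D' i c)
      trace≡' = trans (trace-cross-fromBottom D' (suc f) (suc i) c (D'-full-bottom k k<w))
                      (cong (addBox (suc i) c) (trace-cross-fromBottom D' f i c (D'-full-top k k<w)))
      crosses' : crossesOn D' column ≡ column
      crosses' = trans (crossesOn-cross D' _ (D'-full-bottom k k<w)) (cong ((suc i , c) ∷_) (crossesOn-cross D' [] (D'-full-top k k<w)))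
      crosses : map σ (crossesOn D column) ≡ (i , c) ∷ (suc i , c) ∷ []
      crosses = trans
        (cong (map σ) (trans (crossesOn-cross D _ (full-bottom k k<w)) (cong ((suc i , c) ∷_) (crossesOn-cross D [] (full-top k k<w)))))
        (cong₂ _∷_ (σ-bottom (proj₁ (inside k<w)) (proj₂ (inside k<w))) (cong [_] (σ-top (proj₁ (inside k<w)) (proj₂ (inside k<w)))))
      column-crosses : crossesOn D' column ↭ map σ (crossesOn D column)
      column-crosses = ↭-trans (↭-reflexive crosses') (↭-trans (swap (suc i , c) (i , c) ↭-refl) (↭-reflexive (sym crosses)))

    matches-cornerAcross : ∀ N f → f < N → ∀ {e} → proj₂ (traceFrom f D (state (suc i) a fromLeft)) ≡ just e →
      Matches (traceFrom f D (state (suc i) a fromLeft)) (traceFrom f D' (state (suc i) a fromLeft))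
    matches-cornerAcross zero f () ex
    matches-cornerAcross (suc N) f f<N ex with fuel-exceeds-path cornerAcross f ex
    ... | g , fuel = matches-resp trace≡ trace≡' (matches-prepend _ _ _ _
          (matches-trace N (suc g) (remainingFuel< (2 + w) (suc g) fuel₃ f<N) (state i (suc j) fromLeft) (outside pastRight)
            (trans (cong proj₂ (sym trace≡)) ex))
          cornerAcross-crosses)
      where
      fuel₃ : f ≡ 3 + w + suc g
      fuel₃ = trans fuel (cong (_+ suc g) cornerAcross-length)
      trace≡ : traceFrom f D (state (suc i) a fromLeft) ≡
               prepend (pathBoxes cornerAcross) (traceFrom (suc g) D (state i (suc j) fromLeft))
      trace≡ = trans (cong (λ f → traceFrom f D (state (suc i) a fromLeft)) fuel) (trace-path cornerAcross (suc g))
      trace≡' : traceFrom f D' (state (suc i) a fromLeft) ≡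
                prepend (pathBoxes cornerAcross') (traceFrom (suc g) D' (state i (suc j) fromLeft))
      trace≡' = trans (cong (λ f → traceFrom f D' (state (suc i) a fromLeft)) (trans fuel₃ (cong (_+ suc g) (sym cornerAcross'-length))))
                  (trace-path cornerAcross' (suc g))

    matches-cornerUp : ∀ N f → f < N → ∀ {e} → proj₂ (traceFrom f D (state (suc i) a fromBottom)) ≡ just e →
      Matches (traceFrom f D (state (suc i) a fromBottom)) (traceFrom f D' (state (suc i) a fromBottom))
    matches-cornerUp zero f () ex
    matches-cornerUp (suc N) f f<N ex with fuel-exceeds-path cornerUp f ex
    ... | g , fuel = matches-resp trace≡ trace≡' (matches-prepend _ _ _ _
          (matches-goUp N g (<-trans (n<1+n g) (remainingFuel< (1 + w) (suc g) fuel₂ f<N)) i j (λ _ → entry-aboveTop)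
            (trans (cong proj₂ (sym trace≡)) ex))
          cornerUp-crosses)
      where
      fuel₂ : f ≡ 2 + w + suc g
      fuel₂ = trans fuel (cong (_+ suc g) cornerUp-length)
      trace≡ : traceFrom f D (state (suc i) a fromBottom) ≡ prepend (pathBoxes cornerUp ++ [ X ]) (goUp g D i j)
      trace≡ = trans (cong (λ f → traceFrom f D (state (suc i) a fromBottom)) fuel)
                 (trans (trace-path cornerUp (suc g))
                   (trans (cong (prepend (pathBoxes cornerUp)) (trace-cross-fromBottom D g i j cross-right))
                          (prepend-++ (pathBoxes cornerUp) [ X ] _)))
      trace≡' : traceFrom f D' (state (suc i) a fromBottom) ≡ prepend (pathBoxes cornerUp' ++ [ X ]) (goUp g D' i j)
      trace≡' = trans (cong (λ f → traceFrom f D' (state (suc i) a fromBottom)) (trans fuel₂ (cong (_+ suc g) (sym cornerUp'-length))))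
                  (trans (trace-path cornerUp' (suc g))
                    (trans (cong (prepend (pathBoxes cornerUp')) (trace-elbow-fromLeft D' g i j D'-right))
                           (prepend-++ (pathBoxes cornerUp') [ X ] _)))

  matches-pipe : ∀ p {e} → exitCol n D p ≡ just e → Matches (pipe n D p) (pipe n D' p)
  matches-pipe p ex = matches-trace (suc (2 * n + 2)) (2 * n + 2) ≤-refl (state p 1 fromLeft) (entry-start p) ex

  exitCol-preserved : ∀ p {e} → exitCol n D p ≡ just e → exitCol n D' p ≡ just e
  exitCol-preserved p ex = trans (sym (proj₁ (matches-pipe p ex))) ex

  commonCount-↭ : ∀ Cp Cq C'p C'q → C'p ↭ map σ Cp → C'q ↭ map σ Cq →
    length (filterᵇ (λ b → elemBox b C'q) C'p) ≡ length (filterᵇ (λ b → elemBox b Cq) Cp)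
  commonCount-↭ Cp Cq C'p C'q p↭ q↭ = begin
    length (filterᵇ (λ b → elemBox b C'q) C'p)              ≡⟨ cong length (filterᵇ-cong _ _ C'p (λ b _ → elemBox-↭ b q↭)) ⟩
    length (filterᵇ (λ b → elemBox b (map σ Cq)) C'p)       ≡⟨ ↭-length (filter-↭ (λ b → T? (elemBox b (map σ Cq))) p↭) ⟩
    length (filterᵇ (λ b → elemBox b (map σ Cq)) (map σ Cp)) ≡⟨ cong length (filterᵇ-map _ σ Cp) ⟩
    length (map σ (filterᵇ (λ b → elemBox (σ b) (map σ Cq)) Cp)) ≡⟨ length-map σ (filterᵇ (λ b → elemBox (σ b) (map σ Cq)) Cp) ⟩
    length (filterᵇ (λ b → elemBox (σ b) (map σ Cq)) Cp)    ≡⟨ cong length (filterᵇ-cong _ _ Cp (λ b _ → elemBox-map σ σ-injective b Cq)) ⟩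
    length (filterᵇ (λ b → elemBox b Cq) Cp)                ∎
    where open ≡-Reasoning

  crossCount-preserved : ∀ p q {ep eq} → exitCol n D p ≡ just ep → exitCol n D q ≡ just eq →
    crossCount n D' p q ≡ crossCount n D p q
  crossCount-preserved p q exp exq = commonCount-↭ _ _ _ _ (proj₂ (matches-pipe p exp)) (proj₂ (matches-pipe q exq))

steps⇒between : ∀ (P : ℕ → Bool) {j m} → m ≤ j → (∀ k → 1 ≤ k → k < m → P (j ∸ k) ≡ true) → Between P (j ∸ m) j
steps⇒between P {j} {m} m≤j steps c j∸m<c c<j = subst (λ c → P c ≡ true) (m∸[m∸n]≡n (<⇒≤ c<j))
  (steps (j ∸ c) (m<n⇒0<n∸m c<j) (subst (j ∸ c <_) (m∸[m∸n]≡n m≤j) (∸-monoʳ-< {j} {c} {j ∸ m} j∸m<c (<⇒≤ c<j))))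

between⇒steps : ∀ (P : ℕ → Bool) {j m} → m ≤ j → Between P (j ∸ m) j → ∀ k → 1 ≤ k → k < m → P (j ∸ k) ≡ true
between⇒steps P {j} {m} m≤j between k 1≤k k<m =
  between (j ∸ k) (∸-monoʳ-< {j} {m} {k} k<m m≤j) (∸-monoʳ-< {j} {k} {0} 1≤k (≤-trans (<⇒≤ k<m) m≤j))

chute-fromColumns : ∀ {D i a j w} → suc w + a ≡ j → D i j ≡ true → D i a ≡ false → D (suc i) j ≡ false →
  Between (D i) a j → Between (D (suc i)) a j → Chute D i a w
chute-fromColumns {a = a} refl cross elbowLeft elbowBelow top bottom = record
  { cross-right = cross ; elbow-left = elbowLeft ; elbow-below = elbowBelow
  ; full-top = λ t t<w → top (suc t + a) (s≤s (m≤n+m a t)) (s≤s (+-monoˡ-< a t<w))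
  ; full-bottom = λ t t<w → bottom (suc t + a) (s≤s (m≤n+m a t)) (s≤s (+-monoˡ-< a t<w)) }

lastElbowUpTo : ∀ (P : ℕ → Bool) c →
  (∀ k → 1 ≤ k → k ≤ c → P k ≡ true) ⊎ (∃ λ b → 1 ≤ b × b ≤ c × P b ≡ false × Between P b (suc c))
lastElbowUpTo P zero = inj₁ λ k 1≤k k≤0 → contradiction (≤-trans 1≤k k≤0) λ ()
lastElbowUpTo P (suc c) with P (suc c) in Pc
... | false = inj₂ (suc c , s≤s z≤n , ≤-refl , Pc , λ k c<k k<c → contradiction (≤-pred k<c) (<⇒≱ c<k))
... | true with lastElbowUpTo P c
...   | inj₁ all = inj₁ λ k 1≤k k≤1+c →
  [ (λ k<1+c → all k 1≤k (≤-pred k<1+c)) , (λ { refl → Pc }) ]′ (m≤n⇒m<n∨m≡n k≤1+c)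
...   | inj₂ (b , 1≤b , b≤c , Pb , between) = inj₂ (b , 1≤b , m≤n⇒m≤1+n b≤c , Pb , λ k b<k k<2+c →
  [ between k b<k , (λ { refl → Pc }) ]′ (m≤n⇒m<n∨m≡n (≤-pred k<2+c)))

elbowLeftOf : ∀ (P : ℕ → Bool) j → P j ≡ true → ¬ (∀ k → 1 ≤ k → k ≤ j → P k ≡ true) →
  ∃ λ m → 1 ≤ m × m < j × P (j ∸ m) ≡ false × (∀ k → 1 ≤ k → k < m → P (j ∸ k) ≡ true)
elbowLeftOf P j Pj notAll with lastElbowUpTo P j
... | inj₁ all = contradiction all notAll
... | inj₂ (b , 1≤b , b≤j , Pb , between) =
  j ∸ b , m<n⇒0<n∸m b<j , ∸-monoʳ-< {j} {b} {0} 1≤b b≤j , subst (λ c → P c ≡ false) (sym j∸[j∸b]≡b) Pb ,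
  between⇒steps P (m∸n≤m j b) (subst (λ a → Between P a j) (sym j∸[j∸b]≡b) (λ c b<c c<j → between c b<c (m<n⇒m<1+n c<j)))
  where
  b<j : b < j
  b<j = ≤∧≢⇒< b≤j (λ { refl → contradiction (trans (sym Pj) Pb) λ () })
  j∸[j∸b]≡b : j ∸ (j ∸ b) ≡ b
  j∸[j∸b]≡b = m∸[m∸n]≡n b≤j

pipeDreamFor-exits : ∀ n perm D → IsPipeDreamFor n perm D → PipesExit n D
pipeDreamFor-exits n perm D for (suc p) _ p<n =
  _ , subst (λ q → exitCol n D (suc q) ≡ just (suc (toℕ (perm ⟨$⟩ʳ fromℕ< p<n)))) (toℕ-fromℕ< p<n) (for (fromℕ< p<n))

chuteMove-exists : ∀ {n D i j} → IsPipeDream n D → IsReduced n D → PipesExit n D → 1 ≤ i →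
  leftmostUnpaired n D i ≡ just j → ¬ (∀ k → 1 ≤ k → k ≤ j → D i k ≡ true) → ∃ λ m → ValidM D i j m
chuteMove-exists {n} {D} {suc i₀} {j} pd reduced exits _ lu notAll =
  fromElbow (elbowLeftOf (D (suc i₀)) j (proj₂ (proj₂ (leftmostUnpaired-cross n D i lu))) notAll)
  where
  i = suc i₀
  fromElbow : (∃ λ m → 1 ≤ m × m < j × D i (j ∸ m) ≡ false × (∀ k → 1 ≤ k → k < m → D i (j ∸ k) ≡ true)) →
    ∃ λ m → ValidM D i j m
  fromElbow (suc w , 1≤m , m<j , elbowTop , fullTop) =
    suc w , 1≤m , m<j , (elbowTop , elbowCorner) , λ k 1≤k k<m → fullTop k 1≤k k<m , fullBottom k 1≤k k<m
    where
    a = j ∸ suc w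
    top : Between (D i) a j
    top = steps⇒between (D i) (<⇒≤ m<j) fullTop
    bottom : Between (D (suc i)) a j
    bottom = leftmostUnpaired-fillBelow n D i lu a top
    fullBottom = between⇒steps (D (suc i)) (<⇒≤ m<j) bottom
    elbowCorner : D (suc i) a ≡ false
    elbowCorner = chute-elbow-corner pd reduced exits (m<n⇒0<n∸m m<j)
      (chute-fromColumns (m+[n∸m]≡n (<⇒≤ m<j)) (proj₂ (proj₂ (leftmostUnpaired-cross n D i lu))) elbowTop
        (leftmostUnpaired-elbowBelow n D i lu) top bottom)

chuteMove-inRP : ∀ {n perm D i j m} → InRP n perm D → 1 ≤ i → leftmostUnpaired n D i ≡ just j → ValidM D i j m →
  InRP n perm (chuteMove D i j m)
chuteMove-inRP {n} {perm} {D} {suc i₀} {j} {suc w} (pd , for , reduced) _ lu (1≤m , m<j , (elbowTop , elbowCorner) , full) =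
  chuteMove-isPipeDream pd 1≤m m<j (proj₂ (proj₂ (pd _ _ cross))) ,
  (λ p → exitCol-preserved _ (for p)) ,
  λ p q 1≤p p<q q≤n → subst (_≤ 1)
    (sym (crossCount-preserved p q (proj₂ (exits p 1≤p (≤-trans (<⇒≤ p<q) q≤n)))
                                   (proj₂ (exits q (≤-trans 1≤p (<⇒≤ p<q)) q≤n))))
    (reduced p q 1≤p p<q q≤n)
  where
  i = suc i₀
  a = j ∸ suc w
  exits = pipeDreamFor-exits n perm D for
  cross = proj₂ (proj₂ (leftmostUnpaired-cross n D i lu))
  width : suc w + a ≡ j
  width = m+[n∸m]≡n (<⇒≤ m<j)
  chute : Chute D i a w
  chute = chute-fromColumns width cross elbowTop (leftmostUnpaired-elbowBelow n D i lu)
    (steps⇒between (D i) (<⇒≤ m<j) (λ k 1≤k k<m → proj₁ (full k 1≤k k<m)))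
    (steps⇒between (D (suc i)) (<⇒≤ m<j) (λ k 1≤k k<m → proj₂ (full k 1≤k k<m)))
  source : chuteMove D i j (suc w) i (suc w + a) ≡ false
  source = subst (λ c → chuteMove D i j (suc w) i c ≡ false) (sym width) (chuteMove-source D i j (suc w))
  elsewhere : ∀ r c → ¬ (r ≡ suc i × c ≡ a) → ¬ (r ≡ i × c ≡ suc w + a) → chuteMove D i j (suc w) r c ≡ D r c
  elsewhere r c notTarget notSource = chuteMove-elsewhere D i j (suc w) r c notTarget
    (λ { (r≡i , c≡j) → notSource (r≡i , trans c≡j (sym width)) })
  open ChuteExchange n (m<n⇒0<n∸m m<j) chute elbowCorner (chuteMove-target D i j (suc w)) source elsewhere

proposition2p8 : (n : ℕ) (w : Permutation′ n) (D : Diagram) → InRP n w D →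
    (i : ℕ) → 1 ≤ i → i < n →
    (j : ℕ) → leftmostUnpaired n D i ≡ just j →
    ¬ (∀ k → 1 ≤ k → k ≤ j → D i k ≡ true) →
    (∃ λ m → ValidM D i j m)
    × (∀ m → ValidM D i j m →
        InRP n w (chuteMove D i j m)
        × (∀ r → 1 ≤ r → r ≤ n → wt n (chuteMove D i j m) r ≡ wt n D r - alpha i r))
proposition2p8 n perm D rp@(pd , for , reduced) i 1≤i _ j lu notAll =
  chuteMove-exists pd reduced (pipeDreamFor-exits n perm D for) 1≤i lu notAll ,
  λ { m valid@(1≤m , m<j , (_ , elbowCorner) , _) →
        chuteMove-inRP {perm = perm} rp 1≤i lu valid ,
        λ r _ _ → wt-chuteMove n D i j m 1≤m m<j j≤n cross elbowCorner r }
  where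
  j≤n = proj₁ (proj₂ (leftmostUnpaired-cross n D i lu))
  cross = proj₂ (proj₂ (leftmostUnpaired-cross n D i lu))
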